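{- The map $\pi\mapsto(\mathcal P(\pi),(k,l))$, where $k$ and $l$ are the numbers of reds and blues of the active family $\mathcal A(\pi)$, is a bijection from the set of all primitive permutations (of all sizes $n\ge2$) onto the set of pairs $(\mathcal P,(k,l))$ in which $\mathcal P$ is a pairing sequence and $k,l\ge1$ are integers with $k+l$ equal to the sum of the signs of the entries of $\mathcal P$.
   Context: A sequence family is a sequence of distinct integers $(a_1,\dots,a_k,b_l,\dots,b_1)$ with $k,l\ge1$ and $b_1<\dots<b_l<a_1<\dots<a_k$; the $a_i$ are its reds and the $b_j$ its blues. Permutations are in line notation. Primitive permutations and their active families $\mathcal A(\pi)\subseteq\{1,\dots,n\}$ are defined inductively: $\pi=(2,1)$ is primitive with $\mathcal A(\pi)=\{1,2\}$; for $n>2$, a permutation $\pi$ of $\{1,\dots,n\}$ is primitive if the permutation $\pi'$ of $\{1,\dots,n-1\}$ obtained by deleting $n$ is primitive and $n$ is immediately followed in $\pi$ by some $m\in\mathcal A(\pi')$ (its friend); then either (A) the elements of $\mathcal A(\pi')\cup\{n\}$, listed in their order in $\pi$, form a sequence family, and $\mathcal A(\pi)=\mathcal A(\pi')\cup\{n\}$; or (B) they do not, $\mathcal A(\pi)=\mathcal A(\pi')\setminus\{m\}$, and $(n,m)$ is called a bud. In both cases the elements of $\mathcal A(\pi)$ in their order in $\pi$ form a sequence family, which gives its reds and blues. The buds of $\pi$ are all buds created along this construction; if $\pi$ has $b$ buds and $f=|\mathcal A(\pi)|$ then $2b+f=n$. The pairing pattern $\mathcal P(\pi)$ is the integer sequence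 of length $n$ defined by $\mathcal P((2,1))=(1,2)$ and, for $n>2$: in case (A), $\mathcal P(\pi)$ is $\mathcal P(\pi')$ with $b+f$ appended; in case (B), $\mathcal P(\pi)$ is $\mathcal P(\pi')$ with $-\mathcal P(\pi')_m$ appended, where $\mathcal P(\pi')_m$ is the $m$-th entry of $\mathcal P(\pi')$ and $m$ is the friend of $n$. A pairing sequence is a sequence $(p_1,\dots,p_n)$, $n\ge2$, of nonzero integers with $p_1=1$, $p_2=2$, whose positive entries in order of occurrence are $1,2,3,\dots$, whose negative entries are pairwise distinct and each equal to $-p_j$ for a positive entry $p_j$ occurring earlier, and such that for every $k\in\{3,\dots,n\}$ the number of positive entries among $p_3,\dots,p_k$ is at least the number of negative ones. The sum of signs of $\mathcal P$ is (number of positive entries) $-$ (number of negative entries). -}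

module Defs where

open import Data.Nat as ℕ using (ℕ; zero; suc; _+_; _≤_; _<_; _>_)
open import Data.Integer as ℤ using (ℤ; +_; -_; 0ℤ)
open import Data.List using (List; []; _∷_; _++_; length; filter; take; applyUpTo; map)
open import Data.List.Membership.Propositional using (_∈_)
open import Data.List.Membership.DecPropositional ℕ._≟_ using (_∈?_)
open import Data.List.Relation.Unary.All using (All)
open import Data.List.Relation.Unary.Linked using (Linked)
open import Data.List.Relation.Unary.Unique.Propositional using (Unique)
open import Data.Product using (Σ; ∃; _×_; _,_)
open import Relation.Nullary using (¬_; ¬?)
open import Relation.Binary.PropositionalEquality using (_≡_; _≢_)

-- SeqFamily s k l : the list s of distinct naturals is a sequence family
-- (a₁,…,a_k,b_l,…,b₁) with k reds and l blues.
SeqFamily : List ℕ → ℕ → ℕ → Set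
SeqFamily s k l =
  Σ (List ℕ) λ reds → Σ (List ℕ) λ blues →
    (s ≡ reds ++ blues) × (length reds ≡ k) × (length blues ≡ l) ×
    (1 ≤ k) × (1 ≤ l) ×
    Linked _<_ reds ×
    Linked _>_ blues ×
    All (λ b → All (b <_) reds) blues

IsSeqFamily : List ℕ → Set
IsSeqFamily s = ∃ λ k → ∃ λ l → SeqFamily s k l

inOrder : List ℕ → List ℕ → List ℕ
inOrder π A = filter (λ x → x ∈? A) π

remove : ℕ → List ℕ → List ℕ
remove m A = filter (λ x → ¬? (x ℕ.≟ m)) A

-- 1-indexed entry of a sequence (0 outside the range)
entry : List ℤ → ℕ → ℤ
entry []       _             = 0ℤ
entry (x ∷ xs) zero          = 0ℤ
entry (x ∷ xs) (suc zero)    = x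
entry (x ∷ xs) (suc (suc k)) = entry xs (suc k)

-- Primitive n π A P b : π (line notation, a list) is a primitive
-- permutation of {1,…,n}, with active family A (as a finite set, given
-- by a list), pairing pattern P, and b buds.

data Primitive : ℕ → List ℕ → List ℕ → List ℤ → ℕ → Set where
  base  : Primitive 2 (2 ∷ 1 ∷ []) (1 ∷ 2 ∷ []) (+ 1 ∷ + 2 ∷ []) 0
  stepA : ∀ {n xs ys m A P b} →
          Primitive n (xs ++ m ∷ ys) A P b →
          m ∈ A →
          IsSeqFamily (inOrder (xs ++ suc n ∷ m ∷ ys) (suc n ∷ A)) →
          Primitive (suc n) (xs ++ suc n ∷ m ∷ ys) (suc n ∷ A)
                    (P ++ (+ (b + length (suc n ∷ A)) ∷ [])) b
  -- case (B): (n+1, m) is a bud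
  stepB : ∀ {n xs ys m A P b} →
          Primitive n (xs ++ m ∷ ys) A P b →
          m ∈ A →
          ¬ IsSeqFamily (inOrder (xs ++ suc n ∷ m ∷ ys) (suc n ∷ A)) →
          Primitive (suc n) (xs ++ suc n ∷ m ∷ ys) (remove m A)
                    (P ++ (- entry P m ∷ [])) (suc b)

positives : List ℤ → List ℤ
positives p = filter (λ x → 0ℤ ℤ.<? x) p

negatives : List ℤ → List ℤ
negatives p = filter (λ x → x ℤ.<? 0ℤ) p

sumOfSigns : List ℤ → ℤ
sumOfSigns p = + length (positives p) ℤ.- + length (negatives p)

record PairingSequence (p : List ℤ) : Set where
  field
    rest        : List ℤ
    start       : p ≡ + 1 ∷ + 2 ∷ rest
    nonzero     : All (λ x → x ≢ 0ℤ) p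
    posInOrder  : positives p ≡ applyUpTo (λ i → + suc i) (length (positives p))
    negDistinct : Unique (negatives p)
    negEarlier  : ∀ xs x ys → p ≡ xs ++ x ∷ ys → x ℤ.< 0ℤ → (- x) ∈ xs
    ballot      : ∀ k → length (negatives (take k rest)) ≤ length (positives (take k rest))

module Submission where

-- A new
-- maximum N inserted in front of an entry m keeps a family exactly when m is
-- the first blue (giving one more red) or the sole red (one more blue);
-- otherwise m is `Deletable`, and after deleting it, whether it was a red or
-- a blue is read off from the number `above m` of entries exceeding m.
--
-- Every primitive permutation satisfies `PatternInv` (P is a
-- pairing sequence with b negative and b + |A| positive entries, and A is the
-- set of positions whose positive entry is not yet cancelled) and
-- `ListingInv` (A listed along π is a family and a rearrangement of A).
-- Well-definedness follows at once, as the sum of signs of P is |A|.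
--
-- Injectivity, by induction on derivations: the pattern determines n, A, b,
-- the kind of the last step and, for (B), the friend; the colour counts
-- (k, l) determine the counts before the last step and the friend's index.
--
-- Surjectivity, by induction on the pattern from its end: for a positive last
-- entry insert n + 1 in front of the first blue or the sole red of a
-- preimage; for a negative one delete the cancelled position, from a preimage
-- with one more red or one more blue according to `above`.

open import Defs
open import Data.Nat using (ℕ)
open import Data.Integer using (ℤ; +_)
open import Data.List using (List)
open import Data.Product using (∃; _×_; _,_; proj₁; proj₂)
open import Relation.Binary.PropositionalEquality using (_≡_)

open import Data.Nat as ℕ using (zero; suc; _+_; _≤_; _<_; _>_; z≤n; s≤s; _<?_; pred)
import Data.Nat.Properties as ℕP
open import Data.Integer as ℤ using (-_; 0ℤ; -[1+_]; +[1+_])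
import Data.Integer.Properties as ℤP
open import Data.List using ([]; _∷_; _++_; length; filter; [_]; take; applyUpTo)
open import Data.List.Properties
  using (++-assoc; length-++; filter-++; filter-all; filter-none; filter-accept; filter-reject;
         ∷-injective; ++-identityʳ; length-++-sucʳ; ∷ʳ-injective; take-all; applyUpTo-∷ʳ)
open import Data.List.Membership.Propositional using (_∈_; _∉_)
open import Data.List.Membership.Propositional.Properties
  using (∈-++⁺ˡ; ∈-++⁺ʳ; ∈-++⁻; ∈-filter⁺; ∈-filter⁻; ∈-∃++; ∈-insert)
open import Data.List.Membership.DecPropositional ℕ._≟_ using (_∈?_)
open import Data.List.Reverse using (Reverse; []; _∶_∶ʳ_; reverseView)
open import Data.List.Relation.Unary.Any using (here; there)
open import Data.List.Relation.Unary.All as All using (All; []; _∷_)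
import Data.List.Relation.Unary.All.Properties as AllP
open import Data.List.Relation.Unary.AllPairs as AP using (AllPairs; []; _∷_)
import Data.List.Relation.Unary.AllPairs.Properties as APP
open import Data.List.Relation.Unary.Linked using (Linked; []; [-]; _∷_)
open import Data.List.Relation.Unary.Linked.Properties using (Linked⇒AllPairs; AllPairs⇒Linked)
open import Data.List.Relation.Unary.Unique.Propositional using (Unique)
open import Data.List.Relation.Binary.Permutation.Propositional
  using (_↭_; ↭-refl; ↭-prep; ↭-swap; ↭-sym; module PermutationReasoning)
open import Data.List.Relation.Binary.Permutation.Propositional.Properties
  using (shift; drop-mid; filter-↭; ↭-length; ∈-resp-↭)
open import Data.Sum using (_⊎_; inj₁; inj₂) renaming ([_,_] to either)
open import Data.Empty using (⊥; ⊥-elim)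
open import Function using (_∘_)
open import Level using (0ℓ)
open import Relation.Nullary using (¬_; Dec; yes; no; ¬?)
open import Relation.Unary using (Pred; Decidable)
open import Relation.Binary.Definitions using (tri<; tri≈; tri>)
open import Relation.Binary.PropositionalEquality
  using (refl; sym; trans; cong; cong₂; subst; subst₂; _≢_; module ≡-Reasoning)

++-overlap : ∀ {A : Set} (xs ys us vs : List A) → xs ++ ys ≡ us ++ vs →
  (∃ λ w → us ≡ xs ++ w × ys ≡ w ++ vs) ⊎ (∃ λ w → xs ≡ us ++ w × vs ≡ w ++ ys)
++-overlap [] ys us vs eq = inj₁ (us , refl , eq)
++-overlap (x ∷ xs) ys [] vs eq = inj₂ (x ∷ xs , refl , sym eq)
++-overlap (x ∷ xs) ys (u ∷ us) vs eq with ∷-injective eq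
... | refl , eq′ with ++-overlap xs ys us vs eq′
... | inj₁ (w , e₁ , e₂) = inj₁ (w , cong (x ∷_) e₁ , e₂)
... | inj₂ (w , e₁ , e₂) = inj₂ (w , cong (x ∷_) e₁ , e₂)

++-length-injective : ∀ {A : Set} (xs ys us vs : List A) → xs ++ ys ≡ us ++ vs →
  length xs ≡ length us → xs ≡ us × ys ≡ vs
++-length-injective [] ys [] vs eq _ = refl , eq
++-length-injective (x ∷ xs) ys (u ∷ us) vs eq len with ∷-injective eq
... | refl , eq′ with ++-length-injective xs ys us vs eq′ (ℕP.suc-injective len)
... | refl , e = refl , e

length≡0 : ∀ {A : Set} {xs : List A} → length xs ≡ 0 → xs ≡ []
length≡0 {xs = []} _ = refl

nonempty : ∀ {A : Set} {xs : List A} {k} → length xs ≡ k → 1 ≤ k → ∃ λ a → ∃ λ r → xs ≡ a ∷ r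
nonempty {xs = a ∷ r} _ _ = a , r , refl
nonempty {xs = []} refl ()

length-snoc : ∀ {A : Set} (P : List A) x → length (P ++ [ x ]) ≡ suc (length P)
length-snoc P x = trans (length-++ P) (ℕP.+-comm _ 1)

prefix-shorter : ∀ {A : Set} (xs ys : List A) → length xs ≤ length (xs ++ ys)
prefix-shorter xs ys = subst (length xs ≤_) (sym (length-++ xs)) (ℕP.m≤m+n _ _)

∈-snoc⁻ : ∀ {A : Set} {z x : A} P → z ∈ P ++ [ x ] → z ∈ P ⊎ z ≡ x
∈-snoc⁻ P i with ∈-++⁻ P i
... | inj₁ j = inj₁ j
... | inj₂ (here e) = inj₂ e

All-delete : ∀ {A : Set} {P : A → Set} xs {m ys} → All P (xs ++ m ∷ ys) → All P (xs ++ ys)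
All-delete [] (_ ∷ p) = p
All-delete (x ∷ xs) (px ∷ p) = px ∷ All-delete xs p

All-insert : ∀ {A : Set} {P : A → Set} xs {m ys} → P m → All P (xs ++ ys) → All P (xs ++ m ∷ ys)
All-insert [] pm p = pm ∷ p
All-insert (x ∷ xs) pm (px ∷ p) = px ∷ All-insert xs pm p

AllPairs-++⁻ˡ : ∀ {A : Set} {R : A → A → Set} xs {ys} → AllPairs R (xs ++ ys) → AllPairs R xs
AllPairs-++⁻ˡ [] _ = []
AllPairs-++⁻ˡ (x ∷ xs) (px ∷ p) = AllP.++⁻ˡ xs px ∷ AllPairs-++⁻ˡ xs p

AllPairs-++⁻ʳ : ∀ {A : Set} {R : A → A → Set} xs {ys} → AllPairs R (xs ++ ys) → AllPairs R ys
AllPairs-++⁻ʳ [] p = p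
AllPairs-++⁻ʳ (x ∷ xs) (_ ∷ p) = AllPairs-++⁻ʳ xs p

AllPairs-++⁻× : ∀ {A : Set} {R : A → A → Set} xs {ys} → AllPairs R (xs ++ ys) →
  All (λ x → All (R x) ys) xs
AllPairs-++⁻× [] _ = []
AllPairs-++⁻× (x ∷ xs) (px ∷ p) = AllP.++⁻ʳ xs px ∷ AllPairs-++⁻× xs p

AllPairs-delete : ∀ {A : Set} {R : A → A → Set} xs {m ys} →
  AllPairs R (xs ++ m ∷ ys) → AllPairs R (xs ++ ys)
AllPairs-delete [] (_ ∷ p) = p
AllPairs-delete (x ∷ xs) (px ∷ p) = All-delete xs px ∷ AllPairs-delete xs p

unique-after : ∀ {A : Set} (xs : List A) {m ys} → Unique (xs ++ m ∷ ys) → All (m ≢_) ys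
unique-after xs u with AllPairs-++⁻ʳ xs u
... | h ∷ _ = h

unique-insert : ∀ {A : Set} xs {z : A} {ys} → Unique (xs ++ ys) → z ∉ xs ++ ys →
  Unique (xs ++ z ∷ ys)
unique-insert [] {z} {ys} u z∉ = All.tabulate (λ i e → z∉ (subst (_∈ ys) (sym e) i)) ∷ u
unique-insert (x ∷ xs) (px ∷ u) z∉ =
  All-insert xs (λ e → z∉ (here (sym e))) px ∷ unique-insert xs u (λ i → z∉ (there i))

unique-position : ∀ {A : Set} xs {m : A} {ys us vs} → Unique (xs ++ m ∷ ys) →
  xs ++ m ∷ ys ≡ us ++ m ∷ vs → xs ≡ us × ys ≡ vs
unique-position xs {m} {ys} {us} {vs} u eq with ++-overlap xs (m ∷ ys) us (m ∷ vs) eq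
... | inj₁ ([] , e₁ , e₂) = sym (trans e₁ (++-identityʳ xs)) , proj₂ (∷-injective e₂)
... | inj₂ ([] , e₁ , e₂) = trans e₁ (++-identityʳ us) , sym (proj₂ (∷-injective e₂))
... | inj₁ (w ∷ ws , _ , e₂) with ∷-injective e₂
...   | refl , e₃ = ⊥-elim (All.lookup (unique-after xs u) (subst (m ∈_) (sym e₃) (∈-insert ws)) refl)
unique-position xs {m} {ys} {us} {vs} u eq | inj₂ (w ∷ ws , _ , e₂) with ∷-injective e₂
...   | refl , e₃ = ⊥-elim (All.lookup (unique-after us (subst Unique eq u)) (subst (m ∈_) (sym e₃) (∈-insert ws)) refl)

filter-cong : ∀ {A : Set} {P Q : Pred A 0ℓ} (P? : Decidable P) (Q? : Decidable Q) {xs} →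
  All (λ x → (P x → Q x) × (Q x → P x)) xs → filter P? xs ≡ filter Q? xs
filter-cong P? Q? [] = refl
filter-cong P? Q? {x ∷ xs} ((f , g) ∷ h) with P? x | Q? x
... | yes p | yes q = cong (x ∷_) (filter-cong P? Q? h)
... | yes p | no ¬q = ⊥-elim (¬q (f p))
... | no ¬p | yes q = ⊥-elim (¬p (g q))
... | no ¬p | no ¬q = filter-cong P? Q? h

remove-split : ∀ {A : List ℕ} {m} → Unique A → m ∈ A →
  ∃ λ as → ∃ λ bs → A ≡ as ++ m ∷ bs × remove m A ≡ as ++ bs
remove-split {A} {m} u i with ∈-∃++ i
... | as , bs , refl = as , bs , refl , (begin
    filter ≢m? (as ++ m ∷ bs)            ≡⟨ filter-++ ≢m? as (m ∷ bs) ⟩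
    filter ≢m? as ++ filter ≢m? (m ∷ bs) ≡⟨ cong (filter ≢m? as ++_) (filter-reject ≢m? (λ ne → ne refl)) ⟩
    filter ≢m? as ++ filter ≢m? bs       ≡⟨ cong₂ _++_ (filter-all ≢m? before) (filter-all ≢m? after) ⟩
    as ++ bs                             ∎)
  where
  open ≡-Reasoning
  ≢m? : Decidable (_≢ m)
  ≢m? x = ¬? (x ℕ.≟ m)
  before : All (_≢ m) as
  before = All.map All.head (AllPairs-++⁻× as u)
  after : All (_≢ m) bs
  after = All.map (λ ne e → ne (sym e)) (unique-after as u)

difference⇒sum : ∀ a p q → + a ≡ + p ℤ.- + q → a + q ≡ p
difference⇒sum a p q eq = ℤP.+-injective (begin
  + (a + q)                   ≡⟨ ℤP.pos-+ a q ⟩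
  + a ℤ.+ + q                 ≡⟨ cong (λ z → z ℤ.+ + q) eq ⟩
  (+ p ℤ.- + q) ℤ.+ + q       ≡⟨ ℤP.+-assoc (+ p) (- + q) (+ q) ⟩
  + p ℤ.+ (- + q ℤ.+ + q)     ≡⟨ cong (ℤ._+_ (+ p)) (ℤP.+-inverseˡ (+ q)) ⟩
  + p ℤ.+ 0ℤ                  ≡⟨ ℤP.+-identityʳ (+ p) ⟩
  + p                         ∎)
  where open ≡-Reasoning

sum⇒difference : ∀ a p q → a + q ≡ p → + p ℤ.- + q ≡ + a
sum⇒difference a p q refl = begin
  + (a + q) ℤ.- + q           ≡⟨ cong (λ z → z ℤ.- + q) (ℤP.pos-+ a q) ⟩
  (+ a ℤ.+ + q) ℤ.- + q       ≡⟨ ℤP.+-assoc (+ a) (+ q) (- + q) ⟩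
  + a ℤ.+ (+ q ℤ.- + q)       ≡⟨ cong (ℤ._+_ (+ a)) (ℤP.+-inverseʳ (+ q)) ⟩
  + a ℤ.+ 0ℤ                  ≡⟨ ℤP.+-identityʳ (+ a) ⟩
  + a                         ∎
  where open ≡-Reasoning

above : ℕ → List ℕ → ℕ
above m s = length (filter (m <?_) s)

above-++ : ∀ m xs ys → above m (xs ++ ys) ≡ above m xs + above m ys
above-++ m xs ys = trans (cong length (filter-++ (m <?_) xs ys)) (length-++ (filter (m <?_) xs))

above-all : ∀ m {xs} → All (m <_) xs → above m xs ≡ length xs
above-all m p = cong length (filter-all (m <?_) p)

above-none : ∀ m {xs} → All (_< m) xs → above m xs ≡ 0
above-none m p = cong length (filter-none (m <?_) (All.map ℕP.<⇒≯ p))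

above-self : ∀ m xs → above m (m ∷ xs) ≡ above m xs
above-self m xs = cong length (filter-reject (m <?_) (ℕP.<-irrefl refl))

above-↭ : ∀ m {xs ys} → xs ↭ ys → above m xs ≡ above m ys
above-↭ m p = ↭-length (filter-↭ (m <?_) p)

increasing : ∀ {xs} → Linked _<_ xs → AllPairs _<_ xs
increasing = Linked⇒AllPairs ℕP.<-trans

decreasing : ∀ {xs} → Linked _>_ xs → AllPairs _>_ xs
decreasing = Linked⇒AllPairs (λ a b → ℕP.<-trans b a)

family-length : ∀ {s k l} → SeqFamily s k l → length s ≡ k + l
family-length (reds , _ , refl , refl , refl , _) = length-++ reds

family-k≥1 : ∀ {s k l} → SeqFamily s k l → 1 ≤ k
family-k≥1 (_ , _ , _ , _ , _ , k≥1 , _) = k≥1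

family-length≥2 : ∀ {s k l} → SeqFamily s k l → 2 ≤ length s
family-length≥2 F@(_ , _ , _ , _ , _ , s≤s {n = k} _ , s≤s {n = l} _ , _) =
  subst (2 ≤_) (sym (family-length F)) (s≤s (subst (1 ≤_) (sym (ℕP.+-suc k l)) (s≤s z≤n)))

mkFamily : ∀ {reds blues} → 1 ≤ length reds → 1 ≤ length blues → AllPairs _<_ reds →
  AllPairs _>_ blues → All (λ b → All (b <_) reds) blues →
  SeqFamily (reds ++ blues) (length reds) (length blues)
mkFamily k≥1 l≥1 R B X = _ , _ , refl , refl , refl , k≥1 , l≥1 , AllPairs⇒Linked R , AllPairs⇒Linked B , X

blue-not-red : ∀ {r c w bs} → 1 ≤ length r → AllPairs _<_ (r ++ c ∷ w) →
  All (λ b → All (b <_) r) (c ∷ bs) → ⊥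
blue-not-red {a ∷ r} _ inc (c<r ∷ _) =
  ℕP.<-asym (All.head (All.head (AllPairs-++⁻× (a ∷ r) inc))) (All.head c<r)

family-reds-unique : ∀ {s k l k′ l′} → SeqFamily s k l → SeqFamily s k′ l′ → k ≡ k′
family-reds-unique (r₁ , b₁ , e₁ , refl , _ , k₁ , _ , R₁ , _ , X₁) (r₂ , b₂ , e₂ , refl , _ , k₂ , _ , R₂ , _ , X₂)
  with ++-overlap r₁ b₁ r₂ b₂ (trans (sym e₁) e₂)
... | inj₁ ([] , ea , _) = cong length (trans (sym (++-identityʳ r₁)) (sym ea))
... | inj₁ (c ∷ w , ea , eb) =
  ⊥-elim (blue-not-red k₁ (subst (AllPairs _<_) ea (increasing R₂)) (subst (All _) eb X₁))
... | inj₂ ([] , ea , _) = cong length (trans ea (++-identityʳ r₂))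
... | inj₂ (c ∷ w , ea , eb) =
  ⊥-elim (blue-not-red k₂ (subst (AllPairs _<_) ea (increasing R₁)) (subst (All _) eb X₂))

insert-before-first-blue : ∀ {xs m ys k l N} → SeqFamily (xs ++ m ∷ ys) k l → length xs ≡ k →
  All (_< N) (xs ++ m ∷ ys) → SeqFamily (xs ++ N ∷ m ∷ ys) (suc k) l
insert-before-first-blue {xs} {m} {ys} {N = N} (reds , blues , e , refl , lb , _ , l≥1 , R , B , X) lx below
  with ++-length-injective xs (m ∷ ys) reds blues e lx
... | refl , refl =
  xs ++ [ N ] , m ∷ ys , sym (++-assoc xs [ N ] (m ∷ ys)) , length-snoc xs N , lb , s≤s z≤n , l≥1 ,
  AllPairs⇒Linked (APP.++⁺ (increasing R) ([] ∷ []) (All.map (_∷ []) (AllP.++⁻ˡ xs below))) , B ,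
  All.zipWith (λ (b<xs , b<N) → AllP.++⁺ b<xs (b<N ∷ [])) (X , AllP.++⁻ʳ xs below)

insert-before-sole-red : ∀ {m ys l N} → SeqFamily (m ∷ ys) 1 l → All (_< N) (m ∷ ys) →
  SeqFamily (N ∷ m ∷ ys) 1 (suc l)
insert-before-sole-red {m} {ys} {N = N} (reds , blues , e , lr , refl , _ , _ , _ , B , X) below
  with ++-length-injective [ m ] ys reds blues e (sym lr)
... | refl , refl =
  [ N ] , m ∷ ys , refl , refl , refl , s≤s z≤n , s≤s z≤n , [-] ,
  AllPairs⇒Linked (All.map All.head X ∷ decreasing B) , All.map (_∷ []) below

new-maximum-last-red : ∀ {xs N zs k l} → SeqFamily (xs ++ N ∷ zs) k l → All (_< N) (xs ++ zs) →
  k ≡ suc (length xs) × AllPairs _<_ (xs ++ [ N ]) × AllPairs _>_ zs ×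
  All (λ b → All (b <_) (xs ++ [ N ])) zs
new-maximum-last-red {xs} {N} {zs} (reds , blues , e , refl , _ , k≥1 , _ , R , B , X) below
  with ++-overlap xs (N ∷ zs) reds blues e | nonempty {xs = reds} refl k≥1
... | inj₁ ([] , ea , eb) | a , r , refl =
  ⊥-elim (ℕP.<-asym (All.lookup (AllP.++⁻ˡ xs below) (subst (a ∈_) (trans ea (++-identityʳ xs)) (here refl)))
                    (All.head (All.head (subst (All _) (sym eb) X))))
... | inj₁ (c ∷ [] , ea , eb) | _ with ∷-injective eb
...   | refl , refl =
  trans (cong length ea) (length-snoc xs N) , subst (AllPairs _<_) ea (increasing R) , decreasing B ,
  subst (λ z → All (λ b → All (b <_) z) blues) ea X
new-maximum-last-red {xs} {N} (reds , blues , e , refl , _ , _ , _ , R , _ , _) below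
  | inj₁ (c ∷ d ∷ w , ea , eb) | _ with ∷-injective eb
...   | refl , refl =
  ⊥-elim (ℕP.<-asym (All.head (AP.head (AllPairs-++⁻ʳ xs (subst (AllPairs _<_) ea (increasing R)))))
                    (All.lookup below (∈-++⁺ʳ xs (here refl))))
new-maximum-last-red {xs} (reds , blues , e , refl , _ , _ , _ , _ , _ , X) below
  | inj₂ (w , ea , eb) | a , r , refl =
  ⊥-elim (ℕP.<-asym (All.lookup (AllP.++⁻ˡ xs below) (subst (a ∈_) (sym ea) (here refl)))
                    (All.head (All.lookup (subst (All _) eb X) (∈-insert w))))

insertion-classified : ∀ {xs m ys k l k′ l′ N} → SeqFamily (xs ++ m ∷ ys) k′ l′ →
  SeqFamily (xs ++ N ∷ m ∷ ys) k l → All (_< N) (xs ++ m ∷ ys) →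
  (k ≡ suc k′ × length xs ≡ k′) ⊎ (k ≡ 1 × k′ ≡ 1 × xs ≡ [])
insertion-classified {xs} {m} {ys} {k′ = k′} F G below
  with new-maximum-last-red {xs} G below
... | k≡ , R , B , X with xs | ys | F | family-length≥2 F
...   | [] | [] | _ | s≤s ()
...   | [] | y ∷ ys′ | F′ | _ =
  inj₂ (k≡ , sym (family-reds-unique (mkFamily (s≤s z≤n) (s≤s z≤n) ([] ∷ []) (AP.tail B)
                                                 (All.map (_∷ []) (AP.head B))) F′) , refl)
...   | x ∷ xs′ | _ | F′ | _ = inj₁ (trans k≡ (cong suc e) , e)
  where
  e : length (x ∷ xs′) ≡ k′
  e = family-reds-unique (mkFamily (s≤s z≤n) (s≤s z≤n) (AllPairs-++⁻ˡ (x ∷ xs′) R) B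
                                   (All.map (AllP.++⁻ˡ (x ∷ xs′)) X)) F′

delete-red : ∀ {xs m ys k l} → SeqFamily (xs ++ m ∷ ys) k l → length xs < k → 2 ≤ k →
  SeqFamily (xs ++ ys) (pred k) l
delete-red {xs} {m} {ys} (reds , blues , e , refl , lb , _ , l≥1 , R , B , X) lt k≥2
  with ++-overlap xs (m ∷ ys) reds blues e
... | inj₁ ([] , ea , _) = ⊥-elim (ℕP.<-irrefl (cong length (trans (sym (++-identityʳ xs)) (sym ea))) lt)
... | inj₂ (w , refl , _) = ⊥-elim (ℕP.<⇒≱ lt (prefix-shorter reds w))
... | inj₁ (c ∷ w , refl , eb) with ∷-injective eb
...   | refl , refl =
  xs ++ w , blues , sym (++-assoc xs w blues) , cong pred (sym (length-++-sucʳ xs m w)) , lb ,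
  ℕP.pred-mono-≤ k≥2 , l≥1 , AllPairs⇒Linked (AllPairs-delete xs (increasing R)) , B ,
  All.map (All-delete xs) X

delete-blue : ∀ {xs m ys k l} → SeqFamily (xs ++ m ∷ ys) k l → k < length xs →
  SeqFamily (xs ++ ys) k (pred l)
delete-blue {xs} {m} {ys} (reds , blues , e , lr , refl , k≥1 , _ , R , B , X) lt
  with ++-overlap xs (m ∷ ys) reds blues e
... | inj₁ (w , refl , _) = ⊥-elim (ℕP.<⇒≱ lt (subst (length xs ≤_) lr (prefix-shorter xs w)))
... | inj₂ ([] , ea , _) = ⊥-elim (ℕP.<-irrefl (sym (trans (cong length (trans ea (++-identityʳ reds))) lr)) lt)
... | inj₂ (c ∷ w , refl , refl) =
  reds , c ∷ w ++ ys , ++-assoc reds (c ∷ w) ys , lr , cong pred (sym (length-++-sucʳ (c ∷ w) m ys)) ,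
  k≥1 , subst (1 ≤_) (cong pred (sym (length-++-sucʳ (c ∷ w) m ys))) (s≤s z≤n) , R ,
  AllPairs⇒Linked (AllPairs-delete (c ∷ w) (decreasing B)) , All-delete (c ∷ w) X

above-red : ∀ us m w blues → AllPairs _<_ (us ++ m ∷ w) → All (λ b → All (b <_) (us ++ m ∷ w)) blues →
  above m (us ++ m ∷ w ++ blues) ≡ length w
above-red us m w blues R X = begin
  above m (us ++ m ∷ w ++ blues)         ≡⟨ above-++ m us (m ∷ w ++ blues) ⟩
  above m us + above m (m ∷ w ++ blues)  ≡⟨ cong₂ _+_ (above-none m us<m) (trans (above-self m (w ++ blues)) (above-++ m w blues)) ⟩
  0 + (above m w + above m blues)        ≡⟨ cong₂ _+_ (above-all m (AP.head (AllPairs-++⁻ʳ us R))) (above-none m blues<m) ⟩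
  length w + 0                           ≡⟨ ℕP.+-identityʳ _ ⟩
  length w                               ∎
  where
  open ≡-Reasoning
  us<m : All (_< m) us
  us<m = All.map All.head (AllPairs-++⁻× us R)
  blues<m : All (_< m) blues
  blues<m = All.map (λ b<reds → All.lookup b<reds (∈-insert us)) X

above-blue : ∀ reds w m ys → AllPairs _>_ (w ++ m ∷ ys) → All (λ b → All (b <_) reds) (w ++ m ∷ ys) →
  above m ((reds ++ w) ++ m ∷ ys) ≡ length (reds ++ w)
above-blue reds w m ys B X = begin
  above m ((reds ++ w) ++ m ∷ ys)         ≡⟨ above-++ m (reds ++ w) (m ∷ ys) ⟩
  above m (reds ++ w) + above m (m ∷ ys)  ≡⟨ cong₂ _+_ (above-all m (AllP.++⁺ (All.lookup X (∈-insert w)) m<w))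
                                                      (trans (above-self m ys) (above-none m (AP.head (AllPairs-++⁻ʳ w B)))) ⟩
  length (reds ++ w) + 0                  ≡⟨ ℕP.+-identityʳ _ ⟩
  length (reds ++ w)                      ∎
  where
  open ≡-Reasoning
  m<w : All (m <_) w
  m<w = All.map All.head (AllPairs-++⁻× w B)

-- The colour of the entry m at index |xs| of a family with k reds is read
-- off from `above m`: a red has k = above m + |xs| + 1, a blue has above m = |xs|.
position-above : ∀ {xs m ys k l} → SeqFamily (xs ++ m ∷ ys) k l →
  (length xs < k × above m (xs ++ m ∷ ys) + suc (length xs) ≡ k) ⊎
  (k ≤ length xs × above m (xs ++ m ∷ ys) ≡ length xs)
position-above {xs} {m} {ys} (reds , blues , e , refl , _ , _ , _ , R , B , X)
  with ++-overlap xs (m ∷ ys) reds blues e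
... | inj₁ ([] , ea , eb) =
  inj₂ (asBlue [] (trans (sym (trans ea (++-identityʳ xs))) (sym (++-identityʳ reds))) (sym eb))
  where
  asBlue : ∀ w → xs ≡ reds ++ w → blues ≡ w ++ m ∷ ys →
    length reds ≤ length xs × above m (xs ++ m ∷ ys) ≡ length xs
  asBlue w refl refl = prefix-shorter reds w , above-blue reds w m ys (decreasing B) X
... | inj₂ (w , refl , refl) = inj₂ (prefix-shorter reds w , above-blue reds w m ys (decreasing B) X)
... | inj₁ (c ∷ w , refl , eb) with ∷-injective eb
...   | refl , refl = inj₁ (|xs|<k , trans (cong (_+ suc (length xs)) (above-red xs m w blues (increasing R) X)) count)
  where
  k≡ : length (xs ++ m ∷ w) ≡ suc (length xs + length w)
  k≡ = trans (length-++-sucʳ xs m w) (cong suc (length-++ xs))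
  |xs|<k : length xs < length (xs ++ m ∷ w)
  |xs|<k = subst (length xs <_) (sym k≡) (s≤s (ℕP.m≤m+n _ _))
  count : length w + suc (length xs) ≡ length (xs ++ m ∷ w)
  count = trans (ℕP.+-comm (length w) (suc (length xs))) (sym k≡)

-- The index i of an entry of a family with k reds is deletable if the entry
-- is a red other than the sole red, or a blue other than the first blue.
Deletable : ℕ → ℕ → Set
Deletable i k = (i < k × 2 ≤ k) ⊎ k < i

index-cases : ∀ i k → 1 ≤ k → i ≡ k ⊎ (i ≡ 0 × k ≡ 1) ⊎ Deletable i k
index-cases i k k≥1 with ℕP.<-cmp i k
... | tri≈ _ i≡k _ = inj₁ i≡k
... | tri> _ _ k<i = inj₂ (inj₂ (inj₂ k<i))
index-cases zero (suc zero) _ | tri< _ _ _ = inj₂ (inj₁ (refl , refl))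
index-cases (suc i) (suc zero) _ | tri< (s≤s ()) _ _
index-cases i (suc (suc k)) _ | tri< i<k _ _ = inj₂ (inj₂ (inj₁ (i<k , s≤s (s≤s z≤n))))

failed-insertion-deletable : ∀ {xs m ys k l N} → SeqFamily (xs ++ m ∷ ys) k l →
  All (_< N) (xs ++ m ∷ ys) → ¬ IsSeqFamily (xs ++ N ∷ m ∷ ys) → Deletable (length xs) k
failed-insertion-deletable {xs} F below fails with index-cases (length xs) _ (family-k≥1 F)
... | inj₁ i≡k = ⊥-elim (fails (_ , _ , insert-before-first-blue F i≡k below))
... | inj₂ (inj₂ d) = d
... | inj₂ (inj₁ (i≡0 , refl)) with length≡0 {xs = xs} i≡0
...   | refl = ⊥-elim (fails (_ , _ , insert-before-sole-red F below))

deletable-insertion-fails : ∀ {xs m ys k l N} → SeqFamily (xs ++ m ∷ ys) k l →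
  All (_< N) (xs ++ m ∷ ys) → Deletable (length xs) k → ¬ IsSeqFamily (xs ++ N ∷ m ∷ ys)
deletable-insertion-fails F below d (_ , _ , G) with insertion-classified F G below | d
... | inj₁ (_ , i≡k) | inj₁ (i<k , _) = ℕP.<-irrefl i≡k i<k
... | inj₁ (_ , i≡k) | inj₂ k<i = ℕP.<-irrefl (sym i≡k) k<i
... | inj₂ (_ , refl , _) | inj₁ (_ , s≤s ())
... | inj₂ (_ , refl , refl) | inj₂ ()

delete-deletable : ∀ {xs m ys k l} → SeqFamily (xs ++ m ∷ ys) k l → Deletable (length xs) k →
  IsSeqFamily (xs ++ ys)
delete-deletable F (inj₁ (i<k , k≥2)) = _ , _ , delete-red F i<k k≥2
delete-deletable F (inj₂ k<i) = _ , _ , delete-blue F k<i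

deletion-colour : ∀ {xs m ys k′ l′ k l} → SeqFamily (xs ++ m ∷ ys) k′ l′ → Deletable (length xs) k′ →
  SeqFamily (xs ++ ys) k l →
  (k′ ≡ suc k × above m (xs ++ m ∷ ys) ≤ k) ⊎ (k′ ≡ k × k < above m (xs ++ m ∷ ys))
deletion-colour {xs} {m} {ys} {k′} {k = k} F d G with d | position-above F
... | inj₁ (i<k , _) | inj₂ (k≤i , _) = ⊥-elim (ℕP.<⇒≱ i<k k≤i)
... | inj₂ k<i | inj₁ (i<k , _) = ⊥-elim (ℕP.<-asym k<i i<k)
... | inj₂ k<i | inj₂ (_ , above≡i) = inj₂ (k′≡k , subst (k <_) (sym above≡i) (subst (_< length xs) k′≡k k<i))
  where
  k′≡k : k′ ≡ k
  k′≡k = family-reds-unique (delete-blue F k<i) G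
... | inj₁ (i<k , s≤s (s≤s z≤n)) | inj₁ (_ , count)
  with family-reds-unique (delete-red F i<k (s≤s (s≤s z≤n))) G
...   | refl = inj₁ (refl , ℕP.≤-pred (subst (above m (xs ++ m ∷ ys) <_) count (ℕP.m<m+n _ (s≤s z≤n))))

entry-++ : ∀ (P Q : List ℤ) j → j ≤ length P → entry (P ++ Q) j ≡ entry P j
entry-++ [] [] zero _ = refl
entry-++ [] (x ∷ Q) zero _ = refl
entry-++ (x ∷ P) Q zero _ = refl
entry-++ (x ∷ P) Q (suc zero) _ = refl
entry-++ (x ∷ P) Q (suc (suc j)) (s≤s j≤) = entry-++ P Q (suc j) j≤

entry-last : ∀ (P : List ℤ) x → entry (P ++ [ x ]) (suc (length P)) ≡ x
entry-last [] x = refl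
entry-last (y ∷ P) x = entry-last P x

entry-out : ∀ (P : List ℤ) j → length P < j → entry P j ≡ 0ℤ
entry-out [] j _ = refl
entry-out (x ∷ P) (suc zero) (s≤s ())
entry-out (x ∷ P) (suc (suc j)) (s≤s lt) = entry-out P (suc j) lt

entry-∈ : ∀ (P : List ℤ) j → entry P j ≢ 0ℤ → entry P j ∈ P
entry-∈ [] j ne = ⊥-elim (ne refl)
entry-∈ (x ∷ P) zero ne = ⊥-elim (ne refl)
entry-∈ (x ∷ P) (suc zero) ne = here refl
entry-∈ (x ∷ P) (suc (suc j)) ne = there (entry-∈ P (suc j) ne)

∈-entry : ∀ (P : List ℤ) {y} → y ∈ P → ∃ λ j → entry P (suc j) ≡ y
∈-entry (x ∷ P) (here refl) = 0 , refl
∈-entry (x ∷ P) (there i) with ∈-entry P i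
... | j , e = suc j , e

entry-snoc-cases : ∀ P x j →
  (entry (P ++ [ x ]) j ≡ entry P j) ⊎ (j ≡ suc (length P) × entry (P ++ [ x ]) j ≡ x) ⊎
  (entry (P ++ [ x ]) j ≡ 0ℤ)
entry-snoc-cases P x j with ℕP.<-cmp j (suc (length P))
... | tri< lt _ _ = inj₁ (entry-++ P [ x ] j (ℕP.≤-pred lt))
... | tri≈ _ refl _ = inj₂ (inj₁ (refl , entry-last P x))
... | tri> _ _ gt = inj₂ (inj₂ (entry-out (P ++ [ x ]) j (subst (_< j) (sym (length-snoc P x)) gt)))

positive≢0 : ∀ {x} → 0ℤ ℤ.< x → x ≢ 0ℤ
positive≢0 p e = ℤP.<-irrefl (sym e) p

negative≢0 : ∀ {x} → x ℤ.< 0ℤ → x ≢ 0ℤ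
negative≢0 p e = ℤP.<-irrefl e p

unsigned⇒zero : ∀ x → ¬ 0ℤ ℤ.< x → ¬ x ℤ.< 0ℤ → x ≡ 0ℤ
unsigned⇒zero (+ zero) _ _ = refl
unsigned⇒zero +[1+ n ] ¬pos _ = ⊥-elim (¬pos (ℤ.+<+ (s≤s z≤n)))
unsigned⇒zero -[1+ n ] _ ¬neg = ⊥-elim (¬neg ℤ.-<+)

positives-snoc⁺ : ∀ P {x} → 0ℤ ℤ.< x → positives (P ++ [ x ]) ≡ positives P ++ [ x ]
positives-snoc⁺ P p = trans (filter-++ (0ℤ ℤ.<?_) P _) (cong (positives P ++_) (filter-accept (0ℤ ℤ.<?_) p))

positives-snoc⁻ : ∀ P {x} → ¬ 0ℤ ℤ.< x → positives (P ++ [ x ]) ≡ positives P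
positives-snoc⁻ P p =
  trans (filter-++ (0ℤ ℤ.<?_) P _) (trans (cong (positives P ++_) (filter-reject (0ℤ ℤ.<?_) p)) (++-identityʳ _))

negatives-snoc⁺ : ∀ P {x} → x ℤ.< 0ℤ → negatives (P ++ [ x ]) ≡ negatives P ++ [ x ]
negatives-snoc⁺ P p = trans (filter-++ (ℤ._<? 0ℤ) P _) (cong (negatives P ++_) (filter-accept (ℤ._<? 0ℤ) p))

negatives-snoc⁻ : ∀ P {x} → ¬ x ℤ.< 0ℤ → negatives (P ++ [ x ]) ≡ negatives P
negatives-snoc⁻ P p =
  trans (filter-++ (ℤ._<? 0ℤ) P _) (trans (cong (negatives P ++_) (filter-reject (ℤ._<? 0ℤ) p)) (++-identityʳ _))

#positives-snoc⁺ : ∀ P {x} → 0ℤ ℤ.< x → length (positives (P ++ [ x ])) ≡ suc (length (positives P))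
#positives-snoc⁺ P p = trans (cong length (positives-snoc⁺ P p)) (length-snoc (positives P) _)

#positives-snoc⁻ : ∀ P {x} → ¬ 0ℤ ℤ.< x → length (positives (P ++ [ x ])) ≡ length (positives P)
#positives-snoc⁻ P p = cong length (positives-snoc⁻ P p)

#negatives-snoc⁺ : ∀ P {x} → x ℤ.< 0ℤ → length (negatives (P ++ [ x ])) ≡ suc (length (negatives P))
#negatives-snoc⁺ P p = trans (cong length (negatives-snoc⁺ P p)) (length-snoc (negatives P) _)

#negatives-snoc⁻ : ∀ P {x} → ¬ x ℤ.< 0ℤ → length (negatives (P ++ [ x ])) ≡ length (negatives P)
#negatives-snoc⁻ P p = cong length (negatives-snoc⁻ P p)

nth-positive : ℕ → ℤ
nth-positive i = + suc i

PositivesInOrder : List ℤ → Set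
PositivesInOrder P = positives P ≡ applyUpTo nth-positive (length (positives P))

NegativesEarlier : List ℤ → Set
NegativesEarlier P = ∀ xs x ys → P ≡ xs ++ x ∷ ys → x ℤ.< 0ℤ → (- x) ∈ xs

Surplus : List ℤ → Set
Surplus r = length (negatives r) ≤ length (positives r)

Ballot : List ℤ → Set
Ballot r = ∀ k → Surplus (take k r)

positives-in-order-snoc : ∀ P {x} → PositivesInOrder P →
  (0ℤ ℤ.< x → x ≡ nth-positive (length (positives P))) → PositivesInOrder (P ++ [ x ])
positives-in-order-snoc P {x} inOrder next with 0ℤ ℤ.<? x
... | no ¬pos = trans (positives-snoc⁻ P ¬pos)
                      (trans inOrder (cong (applyUpTo nth-positive) (sym (#positives-snoc⁻ P ¬pos))))
... | yes pos = begin
  positives (P ++ [ x ])                        ≡⟨ positives-snoc⁺ P pos ⟩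
  positives P ++ [ x ]                          ≡⟨ cong₂ (λ a b → a ++ [ b ]) inOrder (next pos) ⟩
  applyUpTo nth-positive L ++ [ nth-positive L ] ≡⟨ applyUpTo-∷ʳ nth-positive L ⟩
  applyUpTo nth-positive (suc L)                 ≡⟨ cong (applyUpTo nth-positive) (sym (#positives-snoc⁺ P pos)) ⟩
  applyUpTo nth-positive (length (positives (P ++ [ x ]))) ∎
  where
  open ≡-Reasoning
  L : ℕ
  L = length (positives P)

positives-in-order-init : ∀ P {x} → PositivesInOrder (P ++ [ x ]) →
  PositivesInOrder P × (0ℤ ℤ.< x → x ≡ nth-positive (length (positives P)))
positives-in-order-init P {x} inOrder with 0ℤ ℤ.<? x
... | no ¬pos = trans (sym (positives-snoc⁻ P ¬pos))
                      (trans inOrder (cong (applyUpTo nth-positive) (#positives-snoc⁻ P ¬pos))) ,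
                λ pos → ⊥-elim (¬pos pos)
... | yes pos = (λ (eq , last) → eq , λ _ → last) (∷ʳ-injective (positives P) (applyUpTo nth-positive L) (begin
  positives P ++ [ x ]                           ≡⟨ sym (positives-snoc⁺ P pos) ⟩
  positives (P ++ [ x ])                         ≡⟨ inOrder ⟩
  applyUpTo nth-positive (length (positives (P ++ [ x ]))) ≡⟨ cong (applyUpTo nth-positive) (#positives-snoc⁺ P pos) ⟩
  applyUpTo nth-positive (suc L)                 ≡⟨ sym (applyUpTo-∷ʳ nth-positive L) ⟩
  applyUpTo nth-positive L ++ [ nth-positive L ] ∎))
  where
  open ≡-Reasoning
  L : ℕ
  L = length (positives P)

snoc-split : ∀ {A : Set} (P : List A) x xs z ys → P ++ [ x ] ≡ xs ++ z ∷ ys →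
  (xs ≡ P × z ≡ x) ⊎ (∃ λ ys′ → P ≡ xs ++ z ∷ ys′)
snoc-split P x xs z ys eq with reverseView ys
... | [] = inj₁ (∷ʳ-injective xs P (sym eq))
... | ys′ ∶ _ ∶ʳ y =
  inj₂ (ys′ , proj₁ (∷ʳ-injective P (xs ++ z ∷ ys′) (trans eq (sym (++-assoc xs (z ∷ ys′) [ y ])))))

negatives-earlier-snoc : ∀ P {x} → NegativesEarlier P → (x ℤ.< 0ℤ → (- x) ∈ P) →
  NegativesEarlier (P ++ [ x ])
negatives-earlier-snoc P earlier cancels xs z ys eq neg with snoc-split P _ xs z ys eq
... | inj₁ (refl , refl) = cancels neg
... | inj₂ (ys′ , eq′) = earlier xs z ys′ eq′ neg

negatives-earlier-init : ∀ P {x} → NegativesEarlier (P ++ [ x ]) → NegativesEarlier P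
negatives-earlier-init P {x} earlier xs z ys eq =
  earlier xs z (ys ++ [ x ]) (trans (cong (_++ [ x ]) eq) (++-assoc xs (z ∷ ys) [ x ]))

negatives-unique-snoc : ∀ P {x} → Unique (negatives P) → (x ℤ.< 0ℤ → x ∉ negatives P) →
  Unique (negatives (P ++ [ x ]))
negatives-unique-snoc P {x} u fresh with x ℤ.<? 0ℤ
... | no ¬neg = subst Unique (sym (negatives-snoc⁻ P ¬neg)) u
... | yes neg = subst Unique (sym (negatives-snoc⁺ P neg))
  (unique-insert (negatives P) (subst Unique (sym (++-identityʳ _)) u)
                 (λ i → fresh neg (subst (x ∈_) (++-identityʳ _) i)))

negatives-unique-init : ∀ P {x} → Unique (negatives (P ++ [ x ])) → Unique (negatives P)
negatives-unique-init P u = AllPairs-++⁻ˡ (negatives P) (subst Unique (filter-++ (ℤ._<? 0ℤ) P _) u)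

take-snoc : ∀ {A : Set} k (r : List A) x → take k (r ++ [ x ]) ≡ take k r ⊎ take k (r ++ [ x ]) ≡ r ++ [ x ]
take-snoc zero r x = inj₁ refl
take-snoc (suc zero) [] x = inj₂ refl
take-snoc (suc (suc k)) [] x = inj₂ refl
take-snoc (suc k) (y ∷ r) x with take-snoc k r x
... | inj₁ e = inj₁ (cong (y ∷_) e)
... | inj₂ e = inj₂ (cong (y ∷_) e)

take-init : ∀ {A : Set} k (r : List A) x → ∃ λ k′ → take k r ≡ take k′ (r ++ [ x ])
take-init zero r x = 0 , refl
take-init (suc k) [] x = 0 , refl
take-init (suc k) (y ∷ r) x with take-init k r x
... | k′ , e = suc k′ , cong (y ∷_) e

ballot-snoc : ∀ {r x} → Ballot r → Surplus (r ++ [ x ]) → Ballot (r ++ [ x ])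
ballot-snoc {r} {x} ballot whole k with take-snoc k r x
... | inj₁ e = subst Surplus (sym e) (ballot k)
... | inj₂ e = subst Surplus (sym e) whole

ballot-init : ∀ {r x} → Ballot (r ++ [ x ]) → Ballot r
ballot-init {r} {x} ballot k with take-init k r x
... | k′ , e = subst Surplus (sym e) (ballot k′)

ballot-whole : ∀ {r} → Ballot r → Surplus r
ballot-whole {r} ballot = subst Surplus (take-all (length r) r ℕP.≤-refl) (ballot (length r))

surplus-rest : ∀ r → length (negatives (+ 1 ∷ + 2 ∷ r)) + 2 ≤ length (positives (+ 1 ∷ + 2 ∷ r)) → Surplus r
surplus-rest r h = ℕP.≤-pred (ℕP.≤-pred (subst (_≤ length (positives (+ 1 ∷ + 2 ∷ r))) (ℕP.+-comm (length (negatives r)) 2) h))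

rest-surplus : ∀ r → Surplus r → length (negatives (+ 1 ∷ + 2 ∷ r)) + 2 ≤ length (positives (+ 1 ∷ + 2 ∷ r))
rest-surplus r h = subst (_≤ length (positives (+ 1 ∷ + 2 ∷ r))) (ℕP.+-comm 2 (length (negatives r))) (s≤s (s≤s h))

rest≡ : ∀ {r} (ps : PairingSequence (+ 1 ∷ + 2 ∷ r)) → PairingSequence.rest ps ≡ r
rest≡ ps = proj₂ (∷-injective (proj₂ (∷-injective (sym (PairingSequence.start ps)))))

pairing-snoc : ∀ {P x} → PairingSequence P → x ≢ 0ℤ →
  (0ℤ ℤ.< x → x ≡ nth-positive (length (positives P))) →
  (x ℤ.< 0ℤ → (- x) ∈ P × x ∉ negatives P) →
  length (negatives (P ++ [ x ])) + 2 ≤ length (positives (P ++ [ x ])) →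
  PairingSequence (P ++ [ x ])
pairing-snoc {P} {x} ps x≢0 next cancels surplus with PairingSequence.rest ps | PairingSequence.start ps
... | r | refl = record
  { rest = r ++ [ x ]
  ; start = refl
  ; nonzero = AllP.++⁺ nonzero (x≢0 ∷ [])
  ; posInOrder = positives-in-order-snoc P posInOrder next
  ; negDistinct = negatives-unique-snoc P negDistinct (λ neg → proj₂ (cancels neg))
  ; negEarlier = negatives-earlier-snoc P negEarlier (λ neg → proj₁ (cancels neg))
  ; ballot = ballot-snoc (subst Ballot (rest≡ ps) ballot) (surplus-rest (r ++ [ x ]) surplus)
  }
  where open PairingSequence ps

pairing-init : ∀ {r x} → PairingSequence (+ 1 ∷ + 2 ∷ r ++ [ x ]) → PairingSequence (+ 1 ∷ + 2 ∷ r)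
pairing-init {r} {x} ps = record
  { rest = r
  ; start = refl
  ; nonzero = AllP.++⁻ˡ (+ 1 ∷ + 2 ∷ r) nonzero
  ; posInOrder = proj₁ (positives-in-order-init (+ 1 ∷ + 2 ∷ r) posInOrder)
  ; negDistinct = negatives-unique-init (+ 1 ∷ + 2 ∷ r) negDistinct
  ; negEarlier = negatives-earlier-init (+ 1 ∷ + 2 ∷ r) negEarlier
  ; ballot = ballot-init (subst Ballot (rest≡ ps) ballot)
  }
  where open PairingSequence ps

pairing-surplus : ∀ {r} → PairingSequence (+ 1 ∷ + 2 ∷ r) →
  length (negatives (+ 1 ∷ + 2 ∷ r)) + 2 ≤ length (positives (+ 1 ∷ + 2 ∷ r))
pairing-surplus {r} ps = rest-surplus r (subst Surplus (rest≡ ps) (ballot-whole (PairingSequence.ballot ps)))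

inOrder-++ : ∀ xs ys A → inOrder (xs ++ ys) A ≡ inOrder xs A ++ inOrder ys A
inOrder-++ xs ys A = filter-++ (_∈? A) xs ys

inOrder-cong : ∀ xs {A B} → All (λ x → (x ∈ A → x ∈ B) × (x ∈ B → x ∈ A)) xs →
  inOrder xs A ≡ inOrder xs B
inOrder-cong xs {A} {B} = filter-cong (_∈? A) (_∈? B)

inOrder-⊆ : ∀ {x} π A → x ∈ inOrder π A → x ∈ π
inOrder-⊆ π A i = proj₁ (∈-filter⁻ (_∈? A) {xs = π} i)

inOrder-at : ∀ xs {m} ys {A} → m ∈ A → inOrder (xs ++ m ∷ ys) A ≡ inOrder xs A ++ m ∷ inOrder ys A
inOrder-at xs {m} ys {A} m∈A = trans (inOrder-++ xs (m ∷ ys) A) (cong (inOrder xs A ++_) (filter-accept (_∈? A) m∈A))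

inOrder-stepA : ∀ xs {m} ys {A n} → All (_≤ n) (xs ++ m ∷ ys) → m ∈ A →
  inOrder (xs ++ suc n ∷ m ∷ ys) (suc n ∷ A) ≡ inOrder xs A ++ suc n ∷ m ∷ inOrder ys A
inOrder-stepA xs {m} ys {A} {n} bounded m∈A = begin
  inOrder (xs ++ suc n ∷ m ∷ ys) (suc n ∷ A)                  ≡⟨ inOrder-++ xs (suc n ∷ m ∷ ys) (suc n ∷ A) ⟩
  inOrder xs (suc n ∷ A) ++ inOrder (suc n ∷ m ∷ ys) (suc n ∷ A) ≡⟨ cong₂ _++_ (sym (old xs (AllP.++⁻ˡ xs bounded))) new ⟩
  inOrder xs A ++ suc n ∷ m ∷ inOrder ys A                    ∎
  where
  open ≡-Reasoning
  old : ∀ zs → All (_≤ n) zs → inOrder zs A ≡ inOrder zs (suc n ∷ A)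
  old zs = inOrder-cong zs ∘ All.map (λ x≤n → there , λ { (here refl) → ⊥-elim (ℕP.<-irrefl refl x≤n) ; (there i) → i })
  new : inOrder (suc n ∷ m ∷ ys) (suc n ∷ A) ≡ suc n ∷ m ∷ inOrder ys A
  new = trans (filter-accept (_∈? (suc n ∷ A)) (here refl))
          (cong (suc n ∷_) (trans (filter-accept (_∈? (suc n ∷ A)) (there m∈A))
            (cong (m ∷_) (sym (old ys (All.tail (AllP.++⁻ʳ xs bounded)))))))

∈-remove⁻ : ∀ {x m A} → x ∈ remove m A → x ∈ A × x ≢ m
∈-remove⁻ {m = m} = ∈-filter⁻ (λ y → ¬? (y ℕ.≟ m))

∈-remove⁺ : ∀ {x m A} → x ∈ A → x ≢ m → x ∈ remove m A
∈-remove⁺ {m = m} = ∈-filter⁺ (λ y → ¬? (y ℕ.≟ m))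

inOrder-stepB : ∀ xs {m} ys {A n} → Unique (xs ++ m ∷ ys) → suc n ∉ A →
  inOrder (xs ++ suc n ∷ m ∷ ys) (remove m A) ≡ inOrder xs A ++ inOrder ys A
inOrder-stepB xs {m} ys {A} {n} u N∉A = begin
  inOrder (xs ++ suc n ∷ m ∷ ys) (remove m A)                        ≡⟨ inOrder-++ xs (suc n ∷ m ∷ ys) (remove m A) ⟩
  inOrder xs (remove m A) ++ inOrder (suc n ∷ m ∷ ys) (remove m A)    ≡⟨ cong₂ _++_ (sym (old xs before)) new ⟩
  inOrder xs A ++ inOrder ys A                                       ∎
  where
  open ≡-Reasoning
  before : All (_≢ m) xs
  before = All.map All.head (AllPairs-++⁻× xs u)
  old : ∀ zs → All (_≢ m) zs → inOrder zs A ≡ inOrder zs (remove m A)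
  old zs = inOrder-cong zs ∘ All.map (λ x≢m → (λ i → ∈-remove⁺ i x≢m) , (proj₁ ∘ ∈-remove⁻ {A = A}))
  new : inOrder (suc n ∷ m ∷ ys) (remove m A) ≡ inOrder ys A
  new = trans (filter-reject (_∈? remove m A) (N∉A ∘ proj₁ ∘ ∈-remove⁻))
          (trans (filter-reject (_∈? remove m A) (λ i → proj₂ (∈-remove⁻ {A = A} i) refl))
            (sym (old ys (All.map (λ m≢x x≡m → m≢x (sym x≡m)) (unique-after xs u)))))

-- Position j of P carries a positive entry whose negative does not occur in P.
-- These positions are exactly the active elements (see PatternInv).
Uncancelled : List ℤ → ℕ → Set
Uncancelled P j = 0ℤ ℤ.< entry P j × (- entry P j) ∉ P

uncancelled-in-range : ∀ P {j} → Uncancelled P j → j ≤ length P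
uncancelled-in-range P {j} (pos , _) with j ℕ.≤? length P
... | yes j≤ = j≤
... | no j≰ = ⊥-elim (positive≢0 pos (entry-out P j (ℕP.≰⇒> j≰)))

uncancelled-snoc-old : ∀ P {x j} → Uncancelled P j → (- entry P j) ≢ x → Uncancelled (P ++ [ x ]) j
uncancelled-snoc-old P {x} {j} u@(pos , ¬cancelled) ¬cancels =
  subst (0ℤ ℤ.<_) (sym same) pos ,
  λ i → either ¬cancelled ¬cancels (∈-snoc⁻ P (subst (λ e → (- e) ∈ P ++ [ x ]) same i))
  where
  same : entry (P ++ [ x ]) j ≡ entry P j
  same = entry-++ P [ x ] j (uncancelled-in-range P u)

uncancelled-snoc-new : ∀ P {x} → 0ℤ ℤ.< x → (- x) ∉ P → Uncancelled (P ++ [ x ]) (suc (length P))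
uncancelled-snoc-new P {x} pos fresh =
  subst (0ℤ ℤ.<_) (sym (entry-last P x)) pos ,
  λ i → either fresh self-cancel (∈-snoc⁻ P (subst (λ e → (- e) ∈ P ++ [ x ]) (entry-last P x) i))
  where
  self-cancel : (- x) ≢ x
  self-cancel e = ℤP.<-asym pos (subst (ℤ._< 0ℤ) e (ℤP.neg-mono-< pos))

uncancelled-snoc⁻ : ∀ P {x j} → Uncancelled (P ++ [ x ]) j →
  (Uncancelled P j × (- entry P j) ≢ x) ⊎ (j ≡ suc (length P) × 0ℤ ℤ.< x)
uncancelled-snoc⁻ P {x} {j} (pos , ¬cancelled) with entry-snoc-cases P x j
... | inj₁ same =
  inj₁ ((subst (0ℤ ℤ.<_) same pos , λ i → ¬cancelled (∈-++⁺ˡ (subst (λ e → (- e) ∈ P) (sym same) i))) ,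
        λ cancels → ¬cancelled (∈-++⁺ʳ P (here (trans (cong -_ same) cancels))))
... | inj₂ (inj₁ (j≡ , new)) = inj₂ (j≡ , subst (0ℤ ℤ.<_) new pos)
... | inj₂ (inj₂ vanishes) = ⊥-elim (positive≢0 pos vanishes)

length-remove : ∀ {A m} → Unique A → m ∈ A → length A ≡ suc (length (remove m A))
length-remove u m∈A with remove-split u m∈A
... | as , bs , refl , removed = trans (length-++-sucʳ as _ bs) (cong (suc ∘ length) (sym removed))

∈⇒length≥1 : ∀ {A : Set} {x : A} {xs} → x ∈ xs → 1 ≤ length xs
∈⇒length≥1 {xs = _ ∷ _} _ = s≤s z≤n

record ActivePositions (P : List ℤ) (A : List ℕ) : Set where
  field
    active⇒uncancelled : ∀ {j} → j ∈ A → Uncancelled P j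
    uncancelled⇒active : ∀ {j} → Uncancelled P j → j ∈ A
    active-injective   : ∀ {i j} → i ∈ A → j ∈ A → entry P i ≡ entry P j → i ≡ j

  active-in-range : ∀ {j} → j ∈ A → j ≤ length P
  active-in-range j∈A = uncancelled-in-range P (active⇒uncancelled j∈A)

  active-entry-snoc : ∀ {j x} → j ∈ A → entry (P ++ [ x ]) j ≡ entry P j
  active-entry-snoc {j} j∈A = entry-++ P _ j (active-in-range j∈A)

append-large : ∀ {P A x} → ActivePositions P A → 0ℤ ℤ.< x → All (λ z → ℤ.∣ z ∣ < ℤ.∣ x ∣) P →
  ActivePositions (P ++ [ x ]) (suc (length P) ∷ A)
append-large {P} {A} {x} act x>0 larger = record
  { active⇒uncancelled = λ { (here refl) → new ; (there j∈A) → old j∈A }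
  ; uncancelled⇒active = now-active
  ; active-injective = injective
  }
  where
  open ActivePositions act
  old : ∀ {j} → j ∈ A → Uncancelled (P ++ [ x ]) j
  old j∈A = uncancelled-snoc-old P (active⇒uncancelled j∈A)
    (λ e → ℤP.<-asym x>0 (subst (ℤ._< 0ℤ) e (ℤP.neg-mono-< (proj₁ (active⇒uncancelled j∈A)))))
  new : Uncancelled (P ++ [ x ]) (suc (length P))
  new = uncancelled-snoc-new P x>0 (λ i → ℕP.<-irrefl (ℤP.∣-i∣≡∣i∣ x) (All.lookup larger i))
  now-active : ∀ {j} → Uncancelled (P ++ [ x ]) j → j ∈ suc (length P) ∷ A
  now-active u with uncancelled-snoc⁻ P u
  ... | inj₁ (uP , _) = there (uncancelled⇒active uP)
  ... | inj₂ (refl , _) = here refl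
  differs : ∀ {j} → j ∈ A → x ≢ entry (P ++ [ x ]) j
  differs j∈A e = ℕP.<-irrefl (cong ℤ.∣_∣ (sym (trans e (active-entry-snoc j∈A))))
    (All.lookup larger (entry-∈ P _ (positive≢0 (proj₁ (active⇒uncancelled j∈A)))))
  injective : ∀ {i j} → i ∈ suc (length P) ∷ A → j ∈ suc (length P) ∷ A →
    entry (P ++ [ x ]) i ≡ entry (P ++ [ x ]) j → i ≡ j
  injective (here refl) (here refl) _ = refl
  injective (here refl) (there j∈A) e = ⊥-elim (differs j∈A (trans (sym (entry-last P x)) e))
  injective (there i∈A) (here refl) e = ⊥-elim (differs i∈A (trans (sym (entry-last P x)) (sym e)))
  injective (there i∈A) (there j∈A) e =
    active-injective i∈A j∈A (trans (sym (active-entry-snoc i∈A)) (trans e (active-entry-snoc j∈A)))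

append-cancelling : ∀ {P A m} → ActivePositions P A → m ∈ A →
  ActivePositions (P ++ [ - entry P m ]) (remove m A)
append-cancelling {P} {A} {m} act m∈A = record
  { active⇒uncancelled = still-uncancelled
  ; uncancelled⇒active = still-active
  ; active-injective = λ i∈ j∈ e → active-injective (kept i∈) (kept j∈)
      (trans (sym (active-entry-snoc (kept i∈))) (trans e (active-entry-snoc (kept j∈))))
  }
  where
  open ActivePositions act
  kept : ∀ {j} → j ∈ remove m A → j ∈ A
  kept = proj₁ ∘ ∈-remove⁻ {A = A}
  still-uncancelled : ∀ {j} → j ∈ remove m A → Uncancelled (P ++ [ - entry P m ]) j
  still-uncancelled j∈ with ∈-remove⁻ {A = A} j∈
  ... | j∈A , j≢m = uncancelled-snoc-old P (active⇒uncancelled j∈A)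
                      (λ e → j≢m (active-injective j∈A m∈A (ℤP.neg-injective e)))
  still-active : ∀ {j} → Uncancelled (P ++ [ - entry P m ]) j → j ∈ remove m A
  still-active u with uncancelled-snoc⁻ P u
  ... | inj₁ (uP , ¬cancels) = ∈-remove⁺ (uncancelled⇒active uP) (λ { refl → ¬cancels refl })
  ... | inj₂ (_ , x>0) = ⊥-elim (ℤP.<-asym x>0 (ℤP.neg-mono-< (proj₁ (active⇒uncancelled m∈A))))

surplus-from-counts : ∀ P {b a} → length (negatives P) ≡ b → length (positives P) ≡ b + a → 2 ≤ a →
  length (negatives P) + 2 ≤ length (positives P)
surplus-from-counts P {b} #neg #pos a≥2 = subst₂ _≤_ (cong (_+ 2) (sym #neg)) (sym #pos) (ℕP.+-monoʳ-≤ b a≥2)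

record PatternInv (n : ℕ) (A : List ℕ) (P : List ℤ) (b : ℕ) : Set where
  field
    pairing    : PairingSequence P
    length-P   : length P ≡ n
    #positives : length (positives P) ≡ b + length A
    #negatives : length (negatives P) ≡ b
    bounded    : All (λ z → ℤ.∣ z ∣ ≤ b + length A) P
    A-unique   : Unique A
    active     : ActivePositions P A

  open ActivePositions active public

  fresh : suc n ∉ A
  fresh i = ℕP.<-irrefl refl (subst (suc n ≤_) length-P (active-in-range i))

pattern-base : PatternInv 2 (1 ∷ 2 ∷ []) (+ 1 ∷ + 2 ∷ []) 0
pattern-base = record
  { pairing = record
    { rest = []
    ; start = refl
    ; nonzero = (λ ()) ∷ (λ ()) ∷ []
    ; posInOrder = refl
    ; negDistinct = []
    ; negEarlier = λ { [] _ _ refl (ℤ.+<+ ()) ; (_ ∷ []) _ _ refl (ℤ.+<+ ()) ; (_ ∷ _ ∷ []) _ _ () }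
    ; ballot = λ { zero → z≤n ; (suc k) → z≤n }
    }
  ; length-P = refl
  ; #positives = refl
  ; #negatives = refl
  ; bounded = s≤s z≤n ∷ ℕP.≤-refl ∷ []
  ; A-unique = ((λ ()) ∷ []) ∷ [] ∷ []
  ; active = record
    { active⇒uncancelled = λ { (here refl) → ℤ.+<+ (s≤s z≤n) , uncancelled
                             ; (there (here refl)) → ℤ.+<+ (s≤s z≤n) , uncancelled }
    ; uncancelled⇒active = λ { {zero} (ℤ.+<+ () , _) ; {suc zero} _ → here refl ; {suc (suc zero)} _ → there (here refl)
                             ; {suc (suc (suc _))} (ℤ.+<+ () , _) }
    ; active-injective = λ { (here refl) (here refl) _ → refl ; (there (here refl)) (there (here refl)) _ → refl
                           ; (here refl) (there (here refl)) () ; (there (here refl)) (here refl) () }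
    }
  }
  where
  uncancelled : ∀ {y} → -[1+ y ] ∉ + 1 ∷ + 2 ∷ []
  uncancelled (here ())
  uncancelled (there (here ()))

pattern-stepA : ∀ {n A P b m} → PatternInv n A P b → m ∈ A →
  PatternInv (suc n) (suc n ∷ A) (P ++ [ + (b + length (suc n ∷ A)) ]) b
pattern-stepA {n} {A} {P} {b} I m∈A = record
  { pairing = pairing-snoc pairing (positive≢0 x>0) (λ _ → x≡next) (λ x<0 → ⊥-elim (ℤP.<-asym x>0 x<0))
                (surplus-from-counts (P ++ [ x ]) #negatives′ #positives′ (s≤s (∈⇒length≥1 m∈A)))
  ; length-P = trans (length-snoc P x) (cong suc length-P)
  ; #positives = #positives′
  ; #negatives = #negatives′
  ; bounded = AllP.++⁺ (All.map (λ z≤ → ℕP.≤-trans z≤ (ℕP.+-monoʳ-≤ b (ℕP.n≤1+n _))) bounded) (ℕP.≤-refl ∷ [])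
  ; A-unique = All.tabulate (λ j∈A N≡j → fresh (subst (_∈ A) (sym N≡j) j∈A)) ∷ A-unique
  ; active = subst (λ j → ActivePositions (P ++ [ x ]) (suc j ∷ A)) length-P (append-large active x>0 larger)
  }
  where
  open PatternInv I
  x : ℤ
  x = + (b + length (suc n ∷ A))
  x≡next : x ≡ nth-positive (length (positives P))
  x≡next = cong +_ (trans (ℕP.+-suc b (length A)) (cong suc (sym #positives)))
  x>0 : 0ℤ ℤ.< x
  x>0 = subst (0ℤ ℤ.<_) (sym x≡next) (ℤ.+<+ (s≤s z≤n))
  larger : All (λ z → ℤ.∣ z ∣ < ℤ.∣ x ∣) P
  larger = All.map (λ z≤ → ℕP.≤-<-trans z≤ (ℕP.+-monoʳ-< b ℕP.≤-refl)) bounded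
  #positives′ : length (positives (P ++ [ x ])) ≡ b + length (suc n ∷ A)
  #positives′ = trans (#positives-snoc⁺ P x>0) (trans (cong suc #positives) (sym (ℕP.+-suc b (length A))))
  #negatives′ : length (negatives (P ++ [ x ])) ≡ b
  #negatives′ = trans (#negatives-snoc⁻ P (ℤP.<-asym x>0)) #negatives

pattern-stepB : ∀ {n A P b m} → PatternInv n A P b → m ∈ A → 2 ≤ length (remove m A) →
  PatternInv (suc n) (remove m A) (P ++ [ - entry P m ]) (suc b)
pattern-stepB {n} {A} {P} {b} {m} I m∈A A′≥2 = record
  { pairing = pairing-snoc pairing (negative≢0 x<0) (λ x>0 → ⊥-elim (ℤP.<-asym x>0 x<0)) cancels
                (surplus-from-counts (P ++ [ x ]) #negatives′ #positives′ A′≥2)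
  ; length-P = trans (length-snoc P x) (cong suc length-P)
  ; #positives = #positives′
  ; #negatives = #negatives′
  ; bounded = AllP.++⁺ (All.map (λ {z} → subst (ℤ.∣ z ∣ ≤_) size) bounded)
                       (subst (_≤ suc b + length (remove m A)) (sym (ℤP.∣-i∣≡∣i∣ (entry P m)))
                              (subst (ℤ.∣ entry P m ∣ ≤_) size (All.lookup bounded m-entry∈P)) ∷ [])
  ; A-unique = APP.filter⁺ (λ y → ¬? (y ℕ.≟ m)) A-unique
  ; active = append-cancelling active m∈A
  }
  where
  open PatternInv I
  x : ℤ
  x = - entry P m
  m-positive : 0ℤ ℤ.< entry P m
  m-positive = proj₁ (active⇒uncancelled m∈A)
  m-entry∈P : entry P m ∈ P
  m-entry∈P = entry-∈ P m (positive≢0 m-positive)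
  x<0 : x ℤ.< 0ℤ
  x<0 = ℤP.neg-mono-< m-positive
  cancels : x ℤ.< 0ℤ → (- x) ∈ P × x ∉ negatives P
  cancels _ = subst (_∈ P) (sym (ℤP.neg-involutive (entry P m))) m-entry∈P ,
              λ i → proj₂ (active⇒uncancelled m∈A) (proj₁ (∈-filter⁻ (ℤ._<? 0ℤ) {xs = P} i))
  size : b + length A ≡ suc b + length (remove m A)
  size = trans (cong (ℕ._+_ b) (length-remove A-unique m∈A)) (ℕP.+-suc b _)
  #positives′ : length (positives (P ++ [ x ])) ≡ suc b + length (remove m A)
  #positives′ = trans (#positives-snoc⁻ P (λ x>0 → ℤP.<-asym x>0 x<0)) (trans #positives size)
  #negatives′ : length (negatives (P ++ [ x ])) ≡ suc b
  #negatives′ = trans (#negatives-snoc⁺ P x<0) (cong suc #negatives)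

record ListingInv (n : ℕ) (π A : List ℕ) : Set where
  field
    π-unique  : Unique π
    π-bounded : All (_≤ n) π
    family    : IsSeqFamily (inOrder π A)
    listing   : inOrder π A ↭ A

  active-in-π : ∀ {j} → j ∈ A → j ∈ π
  active-in-π j∈A = inOrder-⊆ π A (∈-resp-↭ (↭-sym listing) j∈A)

  fresh-in-π : suc n ∉ π
  fresh-in-π i = ℕP.<-irrefl refl (All.lookup π-bounded i)

  listing-below : All (_< suc n) (inOrder π A)
  listing-below = All.tabulate (λ i → s≤s (All.lookup π-bounded (inOrder-⊆ π A i)))

base-family : SeqFamily (inOrder (2 ∷ 1 ∷ []) (1 ∷ 2 ∷ [])) 1 1
base-family = [ 2 ] , [ 1 ] , refl , refl , refl , s≤s z≤n , s≤s z≤n , [-] , [-] , (ℕP.≤-refl ∷ []) ∷ []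

listing-base : ListingInv 2 (2 ∷ 1 ∷ []) (1 ∷ 2 ∷ [])
listing-base = record
  { π-unique = ((λ ()) ∷ []) ∷ [] ∷ []
  ; π-bounded = ℕP.≤-refl ∷ s≤s z≤n ∷ []
  ; family = 1 , 1 , base-family
  ; listing = ↭-swap 2 1 ↭-refl
  }

split-around : ∀ xs {m} ys {A k l} → m ∈ A → SeqFamily (inOrder (xs ++ m ∷ ys) A) k l →
  SeqFamily (inOrder xs A ++ m ∷ inOrder ys A) k l
split-around xs ys m∈A = subst (λ s → SeqFamily s _ _) (inOrder-at xs ys m∈A)

below-around : ∀ {n xs m ys A} → ListingInv n (xs ++ m ∷ ys) A → m ∈ A →
  All (_< suc n) (inOrder xs A ++ m ∷ inOrder ys A)
below-around {xs = xs} {ys = ys} L m∈A = subst (All _) (inOrder-at xs ys m∈A) (ListingInv.listing-below L)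

insert-fresh : ∀ {n xs m ys A} → ListingInv n (xs ++ m ∷ ys) A →
  Unique (xs ++ suc n ∷ m ∷ ys) × All (_≤ suc n) (xs ++ suc n ∷ m ∷ ys)
insert-fresh {xs = xs} L =
  unique-insert xs π-unique fresh-in-π , All-insert xs ℕP.≤-refl (All.map ℕP.m≤n⇒m≤1+n π-bounded)
  where open ListingInv L

listing-stepA : ∀ {n xs ys m A} → ListingInv n (xs ++ m ∷ ys) A → m ∈ A →
  IsSeqFamily (inOrder (xs ++ suc n ∷ m ∷ ys) (suc n ∷ A)) →
  ListingInv (suc n) (xs ++ suc n ∷ m ∷ ys) (suc n ∷ A)
listing-stepA {n} {xs} {ys} {m} {A} L m∈A fam = record
  { π-unique = proj₁ (insert-fresh L)
  ; π-bounded = proj₂ (insert-fresh L)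
  ; family = fam
  ; listing = begin
      inOrder (xs ++ suc n ∷ m ∷ ys) (suc n ∷ A) ≡⟨ inOrder-stepA xs ys π-bounded m∈A ⟩
      inOrder xs A ++ suc n ∷ m ∷ inOrder ys A   ↭⟨ shift (suc n) (inOrder xs A) (m ∷ inOrder ys A) ⟩
      suc n ∷ inOrder xs A ++ m ∷ inOrder ys A   ≡⟨ cong (suc n ∷_) (sym (inOrder-at xs ys m∈A)) ⟩
      suc n ∷ inOrder (xs ++ m ∷ ys) A           ↭⟨ ↭-prep (suc n) listing ⟩
      suc n ∷ A                                  ∎
  }
  where
  open ListingInv L
  open PermutationReasoning

friend-deletable : ∀ {n xs ys m A k l} → ListingInv n (xs ++ m ∷ ys) A → m ∈ A →
  ¬ IsSeqFamily (inOrder (xs ++ suc n ∷ m ∷ ys) (suc n ∷ A)) →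
  SeqFamily (inOrder (xs ++ m ∷ ys) A) k l → Deletable (length (inOrder xs A)) k
friend-deletable {xs = xs} {ys} L m∈A fails F =
  failed-insertion-deletable (split-around xs ys m∈A F) (below-around L m∈A)
    (fails ∘ subst IsSeqFamily (sym (inOrder-stepA xs ys (ListingInv.π-bounded L) m∈A)))

listing-stepB : ∀ {n xs ys m A} → ListingInv n (xs ++ m ∷ ys) A → Unique A → suc n ∉ A → m ∈ A →
  ¬ IsSeqFamily (inOrder (xs ++ suc n ∷ m ∷ ys) (suc n ∷ A)) →
  ListingInv (suc n) (xs ++ suc n ∷ m ∷ ys) (remove m A)
listing-stepB {n} {xs} {ys} {m} {A} L A-unique N∉A m∈A fails with remove-split A-unique m∈A
... | as , bs , A≡ , removed = record
  { π-unique = proj₁ (insert-fresh L)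
  ; π-bounded = proj₂ (insert-fresh L)
  ; family = subst IsSeqFamily (sym listing-eq)
               (delete-deletable (split-around xs ys m∈A F) (friend-deletable L m∈A fails F))
  ; listing = subst₂ _↭_ (sym listing-eq) (sym removed)
                (drop-mid (inOrder xs A) as (subst₂ _↭_ (inOrder-at xs ys m∈A) A≡ listing))
  }
  where
  open ListingInv L
  listing-eq : inOrder (xs ++ suc n ∷ m ∷ ys) (remove m A) ≡ inOrder xs A ++ inOrder ys A
  listing-eq = inOrder-stepB xs ys π-unique N∉A
  F : SeqFamily (inOrder (xs ++ m ∷ ys) A) (proj₁ family) (proj₁ (proj₂ family))
  F = proj₂ (proj₂ family)

listing-length≥2 : ∀ {n π A} → ListingInv n π A → 2 ≤ length A
listing-length≥2 L = subst (2 ≤_) (↭-length listing) (family-length≥2 (proj₂ (proj₂ family)))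
  where open ListingInv L

invariant : ∀ {n π A P b} → Primitive n π A P b → PatternInv n A P b × ListingInv n π A
invariant base = pattern-base , listing-base
invariant (stepA d m∈A fam) with invariant d
... | I , L = pattern-stepA I m∈A , listing-stepA L m∈A fam
invariant (stepB d m∈A fails) with invariant d
... | I , L with listing-stepB L (PatternInv.A-unique I) (PatternInv.fresh I) m∈A fails
... | L′ = pattern-stepB I m∈A (listing-length≥2 L′) , L′

sum-of-signs : ∀ {n A P b} → PatternInv n A P b → sumOfSigns P ≡ + length A
sum-of-signs {A = A} {b = b} I =
  trans (cong₂ (λ p q → + p ℤ.- + q) #positives #negatives) (sum⇒difference (length A) _ b (ℕP.+-comm (length A) b))
  where open PatternInv I

well-defined : ∀ {n π A P b} → Primitive n π A P b →
  PairingSequence P × IsSeqFamily (inOrder π A) ×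
  (∀ k l → SeqFamily (inOrder π A) k l → + (k + l) ≡ sumOfSigns P)
well-defined d with invariant d
... | I , L = PatternInv.pairing I , ListingInv.family L ,
  λ k l F → trans (cong +_ (trans (sym (family-length F)) (↭-length (ListingInv.listing L)))) (sym (sum-of-signs I))

redsBeforeInsertion : ℕ → ℕ
redsBeforeInsertion k = pred k ℕ.⊔ 1

insertion-shape : ∀ {xs m ys k l k′ l′ N} → SeqFamily (xs ++ m ∷ ys) k′ l′ →
  SeqFamily (xs ++ N ∷ m ∷ ys) k l → All (_< N) (xs ++ m ∷ ys) →
  k′ ≡ redsBeforeInsertion k × length xs ≡ pred k
insertion-shape F G below with insertion-classified F G below
... | inj₁ (refl , xs≡) = sym (ℕP.m≥n⇒m⊔n≡m (family-k≥1 F)) , xs≡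
... | inj₂ (refl , refl , refl) = refl , refl

redsBeforeDeletion : ℕ → ℕ → ℕ
redsBeforeDeletion a k with a ℕ.≤? k
... | yes _ = suc k
... | no _ = k

deletion-shape : ∀ {xs m ys k′ l′ k l} → SeqFamily (xs ++ m ∷ ys) k′ l′ → Deletable (length xs) k′ →
  SeqFamily (xs ++ ys) k l → k′ ≡ redsBeforeDeletion (above m (xs ++ m ∷ ys)) k
deletion-shape {xs} {m} {ys} {k = k} F d G with above m (xs ++ m ∷ ys) ℕ.≤? k | deletion-colour F d G
... | yes _ | inj₁ (k′≡ , _) = k′≡
... | yes a≤k | inj₂ (_ , k<a) = ⊥-elim (ℕP.<⇒≱ k<a a≤k)
... | no a≰k | inj₁ (_ , a≤k) = ⊥-elim (a≰k a≤k)
... | no _ | inj₂ (k′≡ , _) = k′≡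

above-listing : ∀ {n xs m ys A} → ListingInv n (xs ++ m ∷ ys) A → m ∈ A →
  above m (inOrder xs A ++ m ∷ inOrder ys A) ≡ above m A
above-listing {xs = xs} {m} {ys} L m∈A =
  trans (cong (above m) (sym (inOrder-at xs ys m∈A))) (above-↭ m (ListingInv.listing L))

same-blues : ∀ {n₁ n₂ π₁ π₂ A k l₁ l₂} → ListingInv n₁ π₁ A → ListingInv n₂ π₂ A →
  SeqFamily (inOrder π₁ A) k l₁ → SeqFamily (inOrder π₂ A) k l₂ → l₁ ≡ l₂
same-blues {π₁ = π₁} {π₂} {A} {k} {l₁} {l₂} L₁ L₂ G₁ G₂ = ℕP.+-cancelˡ-≡ k _ _ (begin
  k + l₁                 ≡⟨ sym (family-length G₁) ⟩
  length (inOrder π₁ A)  ≡⟨ ↭-length (ListingInv.listing L₁) ⟩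
  length A               ≡⟨ sym (↭-length (ListingInv.listing L₂)) ⟩
  length (inOrder π₂ A)  ≡⟨ family-length G₂ ⟩
  k + l₂                 ∎)
  where open ≡-Reasoning

same-index-same-friend : ∀ xs₁ {m₁ ys₁ xs₂ m₂ ys₂ A} → m₁ ∈ A → m₂ ∈ A →
  xs₁ ++ m₁ ∷ ys₁ ≡ xs₂ ++ m₂ ∷ ys₂ → length (inOrder xs₁ A) ≡ length (inOrder xs₂ A) → m₁ ≡ m₂
same-index-same-friend xs₁ {m₁} {ys₁} {xs₂} {m₂} {ys₂} {A} m₁∈A m₂∈A eq same-index =
  proj₁ (∷-injective (proj₂ (++-length-injective _ _ _ _ listings same-index)))
  where
  listings : inOrder xs₁ A ++ m₁ ∷ inOrder ys₁ A ≡ inOrder xs₂ A ++ m₂ ∷ inOrder ys₂ A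
  listings = trans (sym (inOrder-at xs₁ ys₁ m₁∈A)) (trans (cong (λ π → inOrder π A) eq) (inOrder-at xs₂ ys₂ m₂∈A))

insert-in-front : ∀ {A : Set} xs₁ {m : A} {ys₁ xs₂ ys₂} N → Unique (xs₁ ++ m ∷ ys₁) →
  xs₁ ++ m ∷ ys₁ ≡ xs₂ ++ m ∷ ys₂ → xs₁ ++ N ∷ m ∷ ys₁ ≡ xs₂ ++ N ∷ m ∷ ys₂
insert-in-front xs₁ N u eq with unique-position xs₁ u eq
... | refl , refl = refl

SameFamilySamePermutation : List ℕ → List ℕ → List ℕ → Set
SameFamilySamePermutation π₁ π₂ A =
  ∀ {k l} → SeqFamily (inOrder π₁ A) k l → SeqFamily (inOrder π₂ A) k l → π₁ ≡ π₂

split-stepA : ∀ {n xs m ys A k l} → ListingInv n (xs ++ m ∷ ys) A → m ∈ A →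
  SeqFamily (inOrder (xs ++ suc n ∷ m ∷ ys) (suc n ∷ A)) k l →
  SeqFamily (inOrder xs A ++ suc n ∷ m ∷ inOrder ys A) k l
split-stepA {xs = xs} {ys = ys} L m∈A =
  subst (λ s → SeqFamily s _ _) (inOrder-stepA xs ys (ListingInv.π-bounded L) m∈A)

reds-before-bud : ∀ {n xs ys m A k′ l′ k l} → suc n ∉ A → m ∈ A → ListingInv n (xs ++ m ∷ ys) A →
  ¬ IsSeqFamily (inOrder (xs ++ suc n ∷ m ∷ ys) (suc n ∷ A)) →
  SeqFamily (inOrder (xs ++ m ∷ ys) A) k′ l′ → SeqFamily (inOrder (xs ++ suc n ∷ m ∷ ys) (remove m A)) k l →
  k′ ≡ redsBeforeDeletion (above m A) k
reds-before-bud {xs = xs} {ys} {k = k} N∉A m∈A L fails F G =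
  trans (deletion-shape (split-around xs ys m∈A F) (friend-deletable L m∈A fails F)
           (subst (λ s → SeqFamily s _ _) (inOrder-stepB xs ys (ListingInv.π-unique L) N∉A) G))
        (cong (λ a → redsBeforeDeletion a k) (above-listing L m∈A))

-- Two steps (A) from the same n, A leading to families with the same k:
-- the old families have the same colour counts and the friends the same
-- index, so by induction π′ and the friend agree.
stepA-injective : ∀ {n xs₁ ys₁ m₁ xs₂ ys₂ m₂ A k l} →
  ListingInv n (xs₁ ++ m₁ ∷ ys₁) A → m₁ ∈ A → SeqFamily (inOrder (xs₁ ++ suc n ∷ m₁ ∷ ys₁) (suc n ∷ A)) k l →
  ListingInv n (xs₂ ++ m₂ ∷ ys₂) A → m₂ ∈ A → SeqFamily (inOrder (xs₂ ++ suc n ∷ m₂ ∷ ys₂) (suc n ∷ A)) k l →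
  SameFamilySamePermutation (xs₁ ++ m₁ ∷ ys₁) (xs₂ ++ m₂ ∷ ys₂) A →
  xs₁ ++ suc n ∷ m₁ ∷ ys₁ ≡ xs₂ ++ suc n ∷ m₂ ∷ ys₂
stepA-injective {n} {xs₁} {ys₁} {_} {xs₂} {ys₂} L₁ m₁∈A G₁ L₂ m₂∈A G₂ induction
  with ListingInv.family L₁ | ListingInv.family L₂
... | _ , _ , F₁ | _ , _ , F₂
  with insertion-shape (split-around xs₁ ys₁ m₁∈A F₁) (split-stepA L₁ m₁∈A G₁) (below-around L₁ m₁∈A)
     | insertion-shape (split-around xs₂ ys₂ m₂∈A F₂) (split-stepA L₂ m₂∈A G₂) (below-around L₂ m₂∈A)
... | refl , index₁ | refl , index₂ with same-blues L₁ L₂ F₁ F₂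
... | refl with induction F₁ F₂
... | π′-eq with same-index-same-friend xs₁ m₁∈A m₂∈A π′-eq (trans index₁ (sym index₂))
... | refl = insert-in-front xs₁ (suc n) (ListingInv.π-unique L₁) π′-eq

-- Two steps (B) with the same friend m leading to families with the same k:
-- the old families had redsBeforeDeletion (above m A) k reds, so by
-- induction π′ agree.
stepB-injective : ∀ {n xs₁ ys₁ xs₂ ys₂ m A k l} → suc n ∉ A → m ∈ A →
  ListingInv n (xs₁ ++ m ∷ ys₁) A → ¬ IsSeqFamily (inOrder (xs₁ ++ suc n ∷ m ∷ ys₁) (suc n ∷ A)) →
  SeqFamily (inOrder (xs₁ ++ suc n ∷ m ∷ ys₁) (remove m A)) k l →
  ListingInv n (xs₂ ++ m ∷ ys₂) A → ¬ IsSeqFamily (inOrder (xs₂ ++ suc n ∷ m ∷ ys₂) (suc n ∷ A)) →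
  SeqFamily (inOrder (xs₂ ++ suc n ∷ m ∷ ys₂) (remove m A)) k l →
  SameFamilySamePermutation (xs₁ ++ m ∷ ys₁) (xs₂ ++ m ∷ ys₂) A →
  xs₁ ++ suc n ∷ m ∷ ys₁ ≡ xs₂ ++ suc n ∷ m ∷ ys₂
stepB-injective {n} {xs₁} N∉A m∈A L₁ fails₁ G₁ L₂ fails₂ G₂ induction
  with ListingInv.family L₁ | ListingInv.family L₂
... | _ , _ , F₁ | _ , _ , F₂ with reds-before-bud N∉A m∈A L₁ fails₁ F₁ G₁ | reds-before-bud N∉A m∈A L₂ fails₂ F₂ G₂
... | refl | refl with same-blues L₁ L₂ F₁ F₂
... | refl = insert-in-front xs₁ (suc n) (ListingInv.π-unique L₁) (induction F₁ F₂)

pairing-length≥2 : ∀ {P} → PairingSequence P → 2 ≤ length P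
pairing-length≥2 ps = subst (λ P → 2 ≤ length P) (sym (PairingSequence.start ps)) (s≤s (s≤s z≤n))

base-not-extended : ∀ {n π A P b x} → Primitive n π A P b → (+ 1 ∷ + 2 ∷ []) ≢ P ++ [ x ]
base-not-extended {P = P} {x = x} d eq =
  ℕP.<-irrefl refl (subst (3 ≤_) (trans (sym (length-snoc P x)) (sym (cong length eq)))
                         (s≤s (pairing-length≥2 (PatternInv.pairing (proj₁ (invariant d))))))

positive≢cancelling : ∀ {n A P b m} → PatternInv n A P b → m ∈ A → ∀ a → + a ≢ - entry P m
positive≢cancelling I m∈A a e with subst (ℤ._< 0ℤ) (sym e) (ℤP.neg-mono-< (proj₁ (PatternInv.active⇒uncancelled I m∈A)))
... | ℤ.+<+ ()

same-friend : ∀ {n π A P b m₁ m₂} → Primitive n π A P b → m₁ ∈ A → m₂ ∈ A →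
  - entry P m₁ ≡ - entry P m₂ → m₁ ≡ m₂
same-friend d m₁∈A m₂∈A e = PatternInv.active-injective (proj₁ (invariant d)) m₁∈A m₂∈A (ℤP.neg-injective e)

-- The pattern determines n, A and b, and together with the colour counts of
-- the listing also π; by induction on the two derivations, which must end
-- with the same kind of step from the same n, A, b (for (B), the same friend).
pattern-determines : ∀ {n₁ π₁ A₁ P₁ b₁ n₂ π₂ A₂ P₂ b₂} →
  Primitive n₁ π₁ A₁ P₁ b₁ → Primitive n₂ π₂ A₂ P₂ b₂ → P₁ ≡ P₂ →
  n₁ ≡ n₂ × A₁ ≡ A₂ × b₁ ≡ b₂ ×
  (∀ {k l} → SeqFamily (inOrder π₁ A₁) k l → SeqFamily (inOrder π₂ A₂) k l → π₁ ≡ π₂)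
pattern-determines base base _ = refl , refl , refl , λ _ _ → refl
pattern-determines base (stepA d _ _) eq = ⊥-elim (base-not-extended d eq)
pattern-determines base (stepB d _ _) eq = ⊥-elim (base-not-extended d eq)
pattern-determines (stepA d _ _) base eq = ⊥-elim (base-not-extended d (sym eq))
pattern-determines (stepB d _ _) base eq = ⊥-elim (base-not-extended d (sym eq))
pattern-determines (stepA _ _ _) (stepB d₂ m₂∈A _) eq =
  ⊥-elim (positive≢cancelling (proj₁ (invariant d₂)) m₂∈A _ (proj₂ (∷ʳ-injective _ _ eq)))
pattern-determines (stepB d₁ m₁∈A _) (stepA _ _ _) eq =
  ⊥-elim (positive≢cancelling (proj₁ (invariant d₁)) m₁∈A _ (sym (proj₂ (∷ʳ-injective _ _ eq))))
pattern-determines (stepA d₁ m₁∈A _) (stepA d₂ m₂∈A _) eq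
  with pattern-determines d₁ d₂ (proj₁ (∷ʳ-injective _ _ eq))
... | refl , refl , refl , induction = refl , refl , refl ,
  λ G₁ G₂ → stepA-injective (proj₂ (invariant d₁)) m₁∈A G₁ (proj₂ (invariant d₂)) m₂∈A G₂ induction
pattern-determines (stepB d₁ m₁∈A fails₁) (stepB d₂ m₂∈A fails₂) eq with ∷ʳ-injective _ _ eq
... | refl , last with pattern-determines d₁ d₂ refl
... | refl , refl , refl , induction with same-friend d₁ m₁∈A m₂∈A last
... | refl = refl , refl , refl ,
  λ G₁ G₂ → stepB-injective (PatternInv.fresh (proj₁ (invariant d₁))) m₁∈A
              (proj₂ (invariant d₁)) fails₁ G₁ (proj₂ (invariant d₂)) fails₂ G₂ induction

Preimage : List ℤ → ℕ → ℕ → Set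
Preimage P k l = ∃ λ n → ∃ λ π → ∃ λ A → ∃ λ b → Primitive n π A P b × SeqFamily (inOrder π A) k l

listing-unique : ∀ {n π A} → ListingInv n π A → Unique (inOrder π A)
listing-unique {A = A} L = APP.filter⁺ (_∈? A) (ListingInv.π-unique L)

extend-by-insertion : ∀ {n π A P b k l c} → Primitive n π A P b → c ∈ inOrder π A →
  (∀ {xs ys} → inOrder π A ≡ xs ++ c ∷ ys → SeqFamily (xs ++ suc n ∷ c ∷ ys) k l) →
  Preimage (P ++ [ + (b + length (suc n ∷ A)) ]) k l
extend-by-insertion {n} {π} {A} {k = k} {l} {c} d c∈ insertion with ∈-filter⁻ (_∈? A) {xs = π} c∈
... | c∈π , c∈A with ∈-∃++ c∈π
... | xs , ys , refl = _ , _ , _ , _ , stepA d c∈A (_ , _ , G) , G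
  where
  G : SeqFamily (inOrder (xs ++ suc n ∷ c ∷ ys) (suc n ∷ A)) k l
  G = subst (λ s → SeqFamily s _ _) (sym (inOrder-stepA xs ys (ListingInv.π-bounded (proj₂ (invariant d))) c∈A))
            (insertion (inOrder-at xs ys c∈A))

first-blue-insertion : ∀ {s reds c bs k l N xs ys} → Unique s → SeqFamily s k l →
  s ≡ reds ++ c ∷ bs → length reds ≡ k → All (_< N) s → s ≡ xs ++ c ∷ ys →
  SeqFamily (xs ++ N ∷ c ∷ ys) (suc k) l
first-blue-insertion {xs = xs} u F e lr below refl with unique-position xs u e
... | refl , _ = insert-before-first-blue F lr below

sole-red-insertion : ∀ {s a bs l N xs ys} → Unique s → SeqFamily s 1 l →
  s ≡ a ∷ bs → All (_< N) s → s ≡ xs ++ a ∷ ys → SeqFamily (xs ++ N ∷ a ∷ ys) 1 (suc l)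
sole-red-insertion {xs = xs} u F e below refl with unique-position xs {us = []} u e
... | refl , _ = insert-before-sole-red F below

extend-first-blue : ∀ {n π A P b k l} → Primitive n π A P b → SeqFamily (inOrder π A) k l →
  Preimage (P ++ [ + (b + length (suc n ∷ A)) ]) (suc k) l
extend-first-blue d F@(reds , blues , e , lr , lb , _ , l≥1 , _) with nonempty {xs = blues} lb l≥1
... | c , bs , refl =
  extend-by-insertion d (subst (c ∈_) (sym e) (∈-++⁺ʳ reds (here refl)))
    (first-blue-insertion (listing-unique L) F e lr (ListingInv.listing-below L))
  where L = proj₂ (invariant d)

extend-sole-red : ∀ {n π A P b l} → Primitive n π A P b → SeqFamily (inOrder π A) 1 l →
  Preimage (P ++ [ + (b + length (suc n ∷ A)) ]) 1 (suc l)
extend-sole-red d F@(reds , blues , e , lr , _ , k≥1 , _) with nonempty {xs = reds} lr k≥1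
... | a , r , refl with length≡0 {xs = r} (ℕP.suc-injective lr)
... | refl =
  extend-by-insertion d (subst (a ∈_) (sym e) (here refl))
    (sole-red-insertion (listing-unique L) F e (ListingInv.listing-below L))
  where L = proj₂ (invariant d)

extend-by-deletion : ∀ {n π A P b m k′ l′ k l} → Primitive n π A P b → m ∈ A → SeqFamily (inOrder π A) k′ l′ →
  (∀ {xs ys} → SeqFamily (xs ++ m ∷ ys) k′ l′ → above m (xs ++ m ∷ ys) ≡ above m A →
     Deletable (length xs) k′ × SeqFamily (xs ++ ys) k l) →
  Preimage (P ++ [ - entry P m ]) k l
extend-by-deletion {n} {A = A} {m = m} {k′} {k = k} {l} d m∈A F deletion with ∈-∃++ (ListingInv.active-in-π (proj₂ (invariant d)) m∈A)
... | xs , ys , refl = _ , _ , _ , _ , stepB d m∈A fails , G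
  where
  L : ListingInv n (xs ++ m ∷ ys) A
  L = proj₂ (invariant d)
  deleted : Deletable (length (inOrder xs A)) k′ × SeqFamily (inOrder xs A ++ inOrder ys A) k l
  deleted = deletion (split-around xs ys m∈A F) (above-listing L m∈A)
  fails : ¬ IsSeqFamily (inOrder (xs ++ suc n ∷ m ∷ ys) (suc n ∷ A))
  fails = deletable-insertion-fails (split-around xs ys m∈A F) (below-around L m∈A) (proj₁ deleted)
        ∘ subst IsSeqFamily (inOrder-stepA xs ys (ListingInv.π-bounded L) m∈A)
  G : SeqFamily (inOrder (xs ++ suc n ∷ m ∷ ys) (remove m A)) k l
  G = subst (λ s → SeqFamily s _ _) (sym (inOrder-stepB xs ys (ListingInv.π-unique L) (PatternInv.fresh (proj₁ (invariant d)))))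
            (proj₂ deleted)

delete-as-red : ∀ {xs m ys a k l} → 1 ≤ k → a ≤ k → SeqFamily (xs ++ m ∷ ys) (suc k) l →
  above m (xs ++ m ∷ ys) ≡ a → Deletable (length xs) (suc k) × SeqFamily (xs ++ ys) k l
delete-as-red k≥1 a≤k F above≡a with position-above F
... | inj₁ (i<k , _) = inj₁ (i<k , s≤s k≥1) , delete-red F i<k (s≤s k≥1)
... | inj₂ (k<i , above≡i) = ⊥-elim (ℕP.<-irrefl refl (ℕP.≤-trans k<i (subst (_≤ _) (trans (sym above≡a) above≡i) a≤k)))

delete-as-blue : ∀ {xs m ys a k l} → k < a → SeqFamily (xs ++ m ∷ ys) k (suc l) →
  above m (xs ++ m ∷ ys) ≡ a → Deletable (length xs) k × SeqFamily (xs ++ ys) k l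
delete-as-blue {xs} {m} {ys} {k = k} k<a F above≡a with position-above F
... | inj₁ (_ , count) =
  ⊥-elim (ℕP.<-irrefl refl (ℕP.<-≤-trans k<a (subst (_≤ k) above≡a (subst (above m (xs ++ m ∷ ys) ≤_) count (ℕP.m≤m+n _ _)))))
... | inj₂ (_ , above≡i) = inj₂ k<i , delete-blue F k<i
  where
  k<i : k < length xs
  k<i = subst (k <_) (trans (sym above≡a) above≡i) k<a

Surjective : List ℤ → Set
Surjective P = ∀ k l → 1 ≤ k → 1 ≤ l → k + l + length (negatives P) ≡ length (positives P) → Preimage P k l

appended-positive : ∀ {n π A P b x} → Primitive n π A P b → PairingSequence (P ++ [ x ]) → 0ℤ ℤ.< x →
  x ≡ + (b + length (suc n ∷ A))
appended-positive {A = A} {P} {b} d ps x>0 =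
  trans (proj₂ (positives-in-order-init P (PairingSequence.posInOrder ps)) x>0)
        (cong +_ (trans (cong suc (PatternInv.#positives (proj₁ (invariant d)))) (sym (ℕP.+-suc b (length A)))))

k+l≡2 : ∀ {k l} → 1 ≤ k → 1 ≤ l → k + l ≡ 2 → k ≡ 1 × l ≡ 1
k+l≡2 {suc zero} {suc zero} _ _ _ = refl , refl
k+l≡2 {suc zero} {suc (suc l)} _ _ ()
k+l≡2 {suc (suc k)} {suc l} _ _ e with trans (sym (ℕP.+-suc k l)) (ℕP.suc-injective (ℕP.suc-injective e))
... | ()

count-positive : ∀ P {x} k l → 0ℤ ℤ.< x →
  k + l + length (negatives (P ++ [ x ])) ≡ length (positives (P ++ [ x ])) →
  k + l + length (negatives P) ≡ suc (length (positives P))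
count-positive P k l x>0 count =
  trans (cong (ℕ._+_ (k + l)) (sym (#negatives-snoc⁻ P (ℤP.<-asym x>0)))) (trans count (#positives-snoc⁺ P x>0))

count-negative : ∀ P {x} k l → x ℤ.< 0ℤ →
  k + l + length (negatives (P ++ [ x ])) ≡ length (positives (P ++ [ x ])) →
  suc k + l + length (negatives P) ≡ length (positives P)
count-negative P k l x<0 count =
  trans (sym (ℕP.+-suc (k + l) _))
        (trans (cong (ℕ._+_ (k + l)) (sym (#negatives-snoc⁺ P x<0))) (trans count (#positives-snoc⁻ P (λ x>0 → ℤP.<-asym x>0 x<0))))

-- If the last entry x is positive, extend a preimage of the initial part by a step (A):
-- in front of the first blue if k ≥ 2, in front of the sole red if k = 1.
surjective-positive : ∀ {r x} → Surjective (+ 1 ∷ + 2 ∷ r) → PairingSequence (+ 1 ∷ + 2 ∷ r ++ [ x ]) →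
  0ℤ ℤ.< x → Surjective (+ 1 ∷ + 2 ∷ r ++ [ x ])
surjective-positive {r} induction ps x>0 (suc (suc k)) l _ l≥1 count
  with induction (suc k) l (s≤s z≤n) l≥1 (ℕP.suc-injective (count-positive (+ 1 ∷ + 2 ∷ r) _ l x>0 count))
... | _ , _ , _ , _ , d , F =
  subst (λ y → Preimage (+ 1 ∷ + 2 ∷ r ++ [ y ]) (suc (suc k)) l) (sym (appended-positive d ps x>0)) (extend-first-blue d F)
surjective-positive {r} induction ps x>0 (suc zero) (suc (suc l)) _ _ count
  with induction 1 (suc l) (s≤s z≤n) (s≤s z≤n) (ℕP.suc-injective (count-positive (+ 1 ∷ + 2 ∷ r) 1 _ x>0 count))
... | _ , _ , _ , _ , d , F =
  subst (λ y → Preimage (+ 1 ∷ + 2 ∷ r ++ [ y ]) 1 (suc (suc l))) (sym (appended-positive d ps x>0)) (extend-sole-red d F)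
surjective-positive {r} induction ps x>0 (suc zero) (suc zero) _ _ count = ⊥-elim (ℕP.<-irrefl refl too-many)
  where
  -- (k, l) = (1, 1) would leave fewer than two surplus positives
  q : ℕ
  q = length (negatives (+ 1 ∷ + 2 ∷ r))
  too-many : suc q < suc q
  too-many = subst₂ _≤_ (ℕP.+-comm q 2) (sym (ℕP.suc-injective (count-positive (+ 1 ∷ + 2 ∷ r) 1 1 x>0 count)))
                        (pairing-surplus (pairing-init ps))

negative-last-fresh : ∀ P {x} → PairingSequence (P ++ [ x ]) → x ℤ.< 0ℤ → x ∉ P
negative-last-fresh P {x} ps x<0 x∈P =
  All.head (All.lookup (AllPairs-++⁻× (negatives P) distinct) (∈-filter⁺ (ℤ._<? 0ℤ) x∈P x<0)) refl
  where
  distinct : Unique (negatives P ++ [ x ])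
  distinct = subst Unique (negatives-snoc⁺ P x<0) (PairingSequence.negDistinct ps)

-- If the last entry x is negative, it cancels the entry −x at some position m,
-- active in a preimage with k + 1 reds.  A step (B) deletes m: as a red if at
-- most k active elements exceed m, and otherwise as a blue from a preimage
-- with l + 1 blues (which has the same active set).
surjective-negative : ∀ {r x} → Surjective (+ 1 ∷ + 2 ∷ r) → PairingSequence (+ 1 ∷ + 2 ∷ r ++ [ x ]) →
  x ℤ.< 0ℤ → Surjective (+ 1 ∷ + 2 ∷ r ++ [ x ])
surjective-negative {r} {x} induction ps x<0 k l k≥1 l≥1 count
  with ∈-entry (+ 1 ∷ + 2 ∷ r) (PairingSequence.negEarlier ps (+ 1 ∷ + 2 ∷ r) x [] refl x<0)
     | induction (suc k) l (s≤s z≤n) l≥1 (count-negative (+ 1 ∷ + 2 ∷ r) k l x<0 count)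
... | j , entry≡ | _ , _ , A₁ , _ , d₁ , F₁ =
  subst (λ y → Preimage (P′ ++ [ y ]) k l) last≡ (by-colour (above (suc j) A₁ ℕ.≤? k))
  where
  P′ : List ℤ
  P′ = + 1 ∷ + 2 ∷ r
  last≡ : - entry P′ (suc j) ≡ x
  last≡ = trans (cong -_ entry≡) (ℤP.neg-involutive x)
  m∈A₁ : suc j ∈ A₁
  m∈A₁ = PatternInv.uncancelled⇒active (proj₁ (invariant d₁))
           (subst (0ℤ ℤ.<_) (sym entry≡) (ℤP.neg-mono-< x<0) ,
            λ i → negative-last-fresh P′ ps x<0 (subst (_∈ P′) last≡ i))
  by-colour : Dec (above (suc j) A₁ ≤ k) → Preimage (P′ ++ [ - entry P′ (suc j) ]) k l
  by-colour (yes a≤k) = extend-by-deletion d₁ m∈A₁ F₁ (delete-as-red k≥1 a≤k)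
  by-colour (no a≰k)
    with induction k (suc l) k≥1 (s≤s z≤n)
           (trans (cong (_+ length (negatives P′)) (ℕP.+-suc k l)) (count-negative P′ k l x<0 count))
  ... | _ , _ , _ , _ , d₂ , F₂ with pattern-determines d₁ d₂ refl
  ... | refl , refl , refl , _ = extend-by-deletion d₂ m∈A₁ F₂ (delete-as-blue (ℕP.≰⇒> a≰k))

surjective-rest : ∀ {r} → Reverse r → PairingSequence (+ 1 ∷ + 2 ∷ r) → Surjective (+ 1 ∷ + 2 ∷ r)
surjective-rest [] _ k l k≥1 l≥1 count with k+l≡2 k≥1 l≥1 (trans (sym (ℕP.+-identityʳ (k + l))) count)
... | refl , refl = 2 , _ , _ , _ , base , base-family
surjective-rest (r ∶ rs ∶ʳ x) ps with 0ℤ ℤ.<? x | x ℤ.<? 0ℤ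
... | yes x>0 | _ = surjective-positive (surjective-rest rs (pairing-init ps)) ps x>0
... | no _ | yes x<0 = surjective-negative (surjective-rest rs (pairing-init ps)) ps x<0
... | no ¬pos | no ¬neg =
  ⊥-elim (All.lookup (PairingSequence.nonzero ps) (∈-++⁺ʳ (+ 1 ∷ + 2 ∷ r) (here refl)) (unsigned⇒zero x ¬pos ¬neg))

surjective : ∀ P k l → PairingSequence P → 1 ≤ k → 1 ≤ l → + (k + l) ≡ sumOfSigns P → Preimage P k l
surjective P k l ps k≥1 l≥1 signs with PairingSequence.rest ps | PairingSequence.start ps
... | r | refl = surjective-rest (reverseView r) ps k l k≥1 l≥1 (difference⇒sum (k + l) _ _ signs)

mainTheorem8 : (∀ {n π A P b} → Primitive n π A P b →
    PairingSequence P ×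
    (∃ λ k → ∃ λ l → SeqFamily (inOrder π A) k l) ×
    (∀ k l → SeqFamily (inOrder π A) k l → + (k Data.Nat.+ l) ≡ sumOfSigns P))
    × (∀ {n₁ n₂ π₁ π₂ A₁ A₂ b₁ b₂ P k l} →
    Primitive n₁ π₁ A₁ P b₁ → SeqFamily (inOrder π₁ A₁) k l →
    Primitive n₂ π₂ A₂ P b₂ → SeqFamily (inOrder π₂ A₂) k l →
    π₁ ≡ π₂)
    × (∀ P k l → PairingSequence P → 1 Data.Nat.≤ k → 1 Data.Nat.≤ l →
    + (k Data.Nat.+ l) ≡ sumOfSigns P →
    ∃ λ n → ∃ λ π → ∃ λ A → ∃ λ b →
    Primitive n π A P b × SeqFamily (inOrder π A) k l)
mainTheorem8 =
  well-defined ,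
  (λ d₁ G₁ d₂ G₂ → proj₂ (proj₂ (proj₂ (pattern-determines d₁ d₂ refl))) G₁ G₂) ,
  surjective
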